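{- Let $n\ge1$, let $r\ge1$ be an integer and let $\mathcal{C}$ be a partial bijection of $n$ with coset-type $(r+1)$. Then there exist $r$ partial bijections $\tau_1,\dots,\tau_r$ of $n$, each with coset-type $(2)$, such that the coefficient of $\mathcal{C}$ in the product $\tau_1\ast\tau_2\ast\cdots\ast\tau_r\in\mathbb{C}[Q_n]$ is non-zero.
   Context: For $n\ge1$ let $\rho(k)=\{2k-1,2k\}$ and let $\mathbf{P}_n$ be the set of subsets of $[2n]$ that are unions of sets $\rho(k)$, $1\le k\le n$. A partial bijection of $n$ is a triple $\alpha=(\sigma,d,d')$ with $d,d'\in\mathbf{P}_n$ and $\sigma:d\to d'$ a bijection; $Q_n$ is the set of these. Coset-type $ct(\alpha)$: take a graph with vertex set $d$, vertex $x$ having exterior label $x$ and interior label $\sigma(x)$; join by an exterior edge the vertices with exterior labels $2i-1,2i$ and by an interior edge the vertices with interior labels $2i-1,2i$; the graph is a disjoint union of cycles of lengths $2\mu_1\ge2\mu_2\ge\cdots$ and $ct(\alpha)=(\mu_1,\mu_2,\dots)$. For partitions, $\lambda\cup\mu$ adds multiplicities of parts and $(1^j)$ has $j$ parts equal to $1$. $(\tilde\sigma,\tilde d,\tilde d')$ is a trivial extension of $(\sigma,d,d')$ if $d\subseteq\tilde d$, $\tilde\sigma|_d=\sigma$ and $ct(\tilde\sigma)=ct(\sigma)\cup(1^{|\tilde d\setminus d|/2})$; $P_\alpha(n)$ is the set of trivial extensions in $Q_n$. For $\alpha_i=(\sigma_i,d_i,d_i')\in Q_n$, let $E=\{(\tilde\alpha_1,\tilde\alpha_2)\in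 P_{\alpha_1}(n)\times P_{\alpha_2}(n):\tilde d_1=\tilde d_2'=d_1\cup d_2'\}$ and $\alpha_1\ast\alpha_2=\frac1{|E|}\sum_{(\tilde\alpha_1,\tilde\alpha_2)\in E}(\tilde\sigma_1\circ\tilde\sigma_2,\tilde d_2,\tilde d_1')$, extended bilinearly to $\mathbb{C}[Q_n]$; this product is associative. -}

module Defs where

open import Data.Bool using (Bool; true; false; not; _∧_; _∨_; if_then_else_; T)
open import Data.Nat as ℕ using (ℕ; zero; suc; _≤ᵇ_; _≡ᵇ_)
open import Data.Fin as Fin using (Fin)
open import Data.List as List using (List; []; _∷_; _++_; map; filterᵇ; concatMap; cartesianProduct; length; foldr; replicate; findᵇ)
open import Data.List using (allFin)
open import Data.Maybe using (Maybe; just; nothing; is-just; _>>=_)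
open import Data.Product using (Σ; _×_; _,_; proj₁; proj₂)
open import Data.Vec using (Vec; []; _∷_)
open import Data.Integer using (+_)
open import Data.Rational as ℚ using (ℚ; 0ℚ; 1ℚ)

allᵇ : {A : Set} → (A → Bool) → List A → Bool
allᵇ p []       = true
allᵇ p (x ∷ xs) = p x ∧ allᵇ p xs

anyᵇ : {A : Set} → (A → Bool) → List A → Bool
anyᵇ p []       = false
anyᵇ p (x ∷ xs) = p x ∨ anyᵇ p xs

-- Points of [2n].  We identify [2n] with Fin n × Bool: the point
-- (k , false) is 2k+1 and (k , true) is 2k+2 (0-based block index k),
-- so ρ(k+1) = {(k,false),(k,true)}.

Pt : ℕ → Set
Pt n = Fin n × Bool

allPts : (n : ℕ) → List (Pt n)
allPts n = concatMap (λ k → (k , false) ∷ (k , true) ∷ []) (allFin n)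

eqBool : Bool → Bool → Bool
eqBool true  b = b
eqBool false b = not b

eqPt : ∀ {n} → Pt n → Pt n → Bool
eqPt (k , b) (l , c) = (Fin.toℕ k ≡ᵇ Fin.toℕ l) ∧ eqBool b c

idx : ∀ {n} → Pt n → ℕ
idx (k , b) = 2 ℕ.* Fin.toℕ k ℕ.+ (if b then 1 else 0)

eqMPt : ∀ {n} → Maybe (Pt n) → Maybe (Pt n) → Bool
eqMPt (just x) (just y) = eqPt x y
eqMPt nothing  nothing  = true
eqMPt _        _        = false

partner : ∀ {n} → Pt n → Pt n
partner (k , b) = (k , not b)

-- Raw partial maps [2n] ⇀ [2n].  A partial bijection (σ,d,d') is
-- determined by σ viewed as a partial map with domain d; d' is its image.

Raw : ℕ → Set
Raw n = Pt n → Maybe (Pt n)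

inDom : ∀ {n} → Raw n → Pt n → Bool
inDom σ x = is-just (σ x)

inIm : ∀ {n} → Raw n → Pt n → Bool
inIm {n} σ y = anyᵇ (λ x → eqMPt (σ x) (just y)) (allPts n)

valid : ∀ {n} → Raw n → Bool
valid {n} σ =
  allᵇ (λ k → eqBool (inDom σ (k , false)) (inDom σ (k , true))
           ∧ eqBool (inIm σ (k , false)) (inIm σ (k , true))) (allFin n)
  ∧ allᵇ (λ x → allᵇ (λ y → not (inDom σ x ∧ eqMPt (σ x) (σ y)) ∨ eqPt x y)
                   (allPts n)) (allPts n)

Q : ℕ → Set
Q n = Σ (Raw n) (λ σ → T (valid σ))

eqRaw : ∀ {n} → Raw n → Raw n → Bool
eqRaw {n} σ τ = allᵇ (λ x → eqMPt (σ x) (τ x)) (allPts n)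

allMPts : (n : ℕ) → List (Maybe (Pt n))
allMPts n = nothing ∷ map just (allPts n)

funsOn : ∀ {n} → List (Pt n) → List (Raw n)
funsOn {n} []       = (λ _ → nothing) ∷ []
funsOn {n} (p ∷ ps) =
  concatMap (λ v → map (λ f → λ x → if eqPt x p then v else f x) (funsOn ps))
            (allMPts n)

validRaws : (n : ℕ) → List (Raw n)
validRaws n = filterᵇ valid (funsOn (allPts n))

-- In the graph of the paper, walking from a vertex x along its exterior
-- edge and then along the interior edge gives  g x = σ⁻¹(partner(σ(partner x))).
-- A cycle of length 2μ through x consists of the g-orbit of x (μ vertices)
-- and the g-orbit of partner x (μ vertices).

inv : ∀ {n} → Raw n → Pt n → Maybe (Pt n)
inv {n} σ y = findᵇ (λ x → eqMPt (σ x) (just y)) (allPts n)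

step : ∀ {n} → Raw n → Pt n → Maybe (Pt n)
step σ x = σ (partner x) >>= λ y → inv σ (partner y)

iter : ∀ {n} → Raw n → ℕ → Pt n → Maybe (Pt n)
iter σ zero    x = just x
iter σ (suc m) x = iter σ m x >>= step σ

-- g-orbit size of x: least m ∈ [1, 2n] with g^m x = x (0 if none)
orbSizeFrom : ∀ {n} → Raw n → Pt n → ℕ → List ℕ → ℕ
orbSizeFrom σ x d []       = d
orbSizeFrom σ x d (m ∷ ms) = if eqMPt (iter σ m x) (just x) then m else orbSizeFrom σ x d ms

range1 : ℕ → List ℕ
range1 zero    = []
range1 (suc N) = range1 N ++ (suc N ∷ [])

orbSize : ∀ {n} → Raw n → Pt n → ℕ
orbSize {n} σ x = orbSizeFrom σ x 0 (range1 (2 ℕ.* n))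

onCycle : ∀ {n} → Raw n → Pt n → Pt n → Bool
onCycle {n} σ x y =
  anyᵇ (λ m → eqMPt (iter σ m x) (just y) ∨ eqMPt (iter σ m (partner x)) (just y))
      (0 ∷ range1 (2 ℕ.* n))

isRep : ∀ {n} → Raw n → Pt n → Bool
isRep {n} σ x = inDom σ x ∧ allᵇ (λ y → not (onCycle σ x y) ∨ (idx x ≤ᵇ idx y)) (allPts n)

-- partitions are represented as weakly decreasing lists of positive parts
insertDesc : ℕ → List ℕ → List ℕ
insertDesc a []       = a ∷ []
insertDesc a (b ∷ bs) = if b ≤ᵇ a then a ∷ b ∷ bs else b ∷ insertDesc a bs

sortDesc : List ℕ → List ℕ
sortDesc = foldr insertDesc []

ct : ∀ {n} → Raw n → List ℕ
ct {n} σ = sortDesc (map (orbSize σ) (filterᵇ (isRep σ) (allPts n)))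

eqList : List ℕ → List ℕ → Bool
eqList []       []       = true
eqList (a ∷ as) (b ∷ bs) = (a ≡ᵇ b) ∧ eqList as bs
eqList _        _        = false

blocksOfDom : ∀ {n} → Raw n → ℕ     -- |d| / 2
blocksOfDom {n} σ = length (filterᵇ (λ k → inDom σ (k , false)) (allFin n))

isTrivExt : ∀ {n} → Raw n → Raw n → Bool
isTrivExt {n} σ σ̃ =
  allᵇ (λ x → not (inDom σ x) ∨ eqMPt (σ̃ x) (σ x)) (allPts n)
  ∧ eqList (ct σ̃) (sortDesc (ct σ ++ replicate (blocksOfDom σ̃ ℕ.∸ blocksOfDom σ) 1))

PExt : ∀ {n} → Raw n → List (Raw n)
PExt {n} σ = filterᵇ (isTrivExt σ) (validRaws n)

compose : ∀ {n} → Raw n → Raw n → Raw n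
compose σ₁ σ₂ x = σ₂ x >>= σ₁

Eset : ∀ {n} → Raw n → Raw n → List (Raw n × Raw n)
Eset {n} σ₁ σ₂ =
  filterᵇ (λ p → allᵇ (λ x → eqBool (inDom (proj₁ p) x) (inDom σ₁ x ∨ inIm σ₂ x)
                          ∧ eqBool (inIm (proj₂ p) x) (inDom σ₁ x ∨ inIm σ₂ x))
                     (allPts n))
          (cartesianProduct (PExt σ₁) (PExt σ₂))

divℚ : ℕ → ℕ → ℚ
divℚ a zero    = 0ℚ
divℚ a (suc m) = (+ a) ℚ./ suc m

basisProd : ∀ {n} → Raw n → Raw n → Raw n → ℚ
basisProd σ₁ σ₂ γ =
  divℚ (length (filterᵇ (λ p → eqRaw (compose (proj₁ p) (proj₂ p)) γ) (Eset σ₁ σ₂)))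
       (length (Eset σ₁ σ₂))

-- Elements of the algebra (with rational coefficients) as coefficient
-- functions on partial bijections, and their bilinear product.

Elt : ℕ → Set
Elt n = Raw n → ℚ

sumℚ : List ℚ → ℚ
sumℚ = foldr ℚ._+_ 0ℚ

basis : ∀ {n} → Q n → Elt n
basis α γ = if eqRaw (proj₁ α) γ then 1ℚ else 0ℚ

zeroElt : ∀ {n} → Elt n
zeroElt _ = 0ℚ

_⋆_ : ∀ {n} → Elt n → Elt n → Elt n
_⋆_ {n} f g γ =
  sumℚ (map (λ a → sumℚ (map (λ b → f a ℚ.* g b ℚ.* basisProd a b γ) (validRaws n)))
            (validRaws n))

-- τ₁ ∗ τ₂ ∗ ⋯ ∗ τᵣ  (bracketed to the right; the product is associative).
-- The empty product is never used below (r ≥ 1).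
prodVec : ∀ {n r} → Vec (Q n) r → Elt n
prodVec []           = zeroElt
prodVec (t ∷ [])     = basis t
prodVec (t ∷ u ∷ ts) = basis t ⋆ prodVec (u ∷ ts)

coeff : ∀ {n} → Elt n → Q n → ℚ
coeff f C = f (proj₁ C)

cosetType : ∀ {n} → Q n → List ℕ
cosetType α = ct (proj₁ α)

-- Induction on r; for r = 1 take τ₁ = C.  A coset-type (r + 1) means that the graph of C is
-- one cycle, i.e. the walk g = σ⁻¹ ∘ partner ∘ σ ∘ partner has a single orbit pair.  Pick z in
-- the domain with C z = u, C (partner z) = v and let s swap v and partner u.  Then C = τ̃ ∘ C̃
-- with C̃ = s ∘ C and τ̃ = s on Im C.  Dropping the block of z from C̃ leaves C' of coset-type
-- (r), restricting τ̃ to the blocks of u and v leaves τ of coset-type (2), and C̃, τ̃ are trivial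
-- extensions of C', τ whose domains match as E requires.  So C has a positive coefficient in
-- τ ∗ C', and since every coefficient of a product of basis elements is non-negative, the
-- positive coefficient of C' in τ₂ ∗ ⋯ ∗ τᵣ (induction) gives one of C in τ ∗ τ₂ ∗ ⋯ ∗ τᵣ.

module Submission where

open import Defs
open import Data.Bool using (Bool; true; false; not; _∧_; _∨_; if_then_else_; T)
open import Data.Bool.Properties using (T-≡; ∧-zeroʳ) renaming (_≟_ to _≟ᴮ_)
open import Data.Nat using (ℕ; zero; suc; _+_; _*_; _∸_; _≤_; _<_; _≤ᵇ_; _≡ᵇ_; z≤n; s≤s)
import Data.Nat.Properties as ℕP
open import Data.Nat.DivMod using (_%_; _/_; m≡m%n+[m/n]*n; m%n<n; [m+kn]%n≡m%n)
open import Data.Fin as Fin using (Fin)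
import Data.Fin.Properties as FinP
open import Data.List
  using (List; []; _∷_; _++_; map; filterᵇ; concatMap; length; replicate; findᵇ; allFin; cartesianProduct)
import Data.List.Properties as ListP
open import Data.List.Membership.Propositional using (_∈_; _∉_; lose)
open import Data.List.Membership.Propositional.Properties
  using (∈-allFin; ∈-filter⁺; ∈-filter⁻; ∈-map⁺; ∈-concatMap⁺; ∈-cartesianProduct⁺; ∈-++⁺ˡ; ∈-++⁺ʳ)
open import Data.List.Relation.Unary.Any using (here; there)
open import Data.List.Relation.Unary.All using (All; []; _∷_)
open import Data.List.Relation.Unary.All.Properties using (All¬⇒¬Any)
open import Data.List.Relation.Unary.AllPairs using ([]; _∷_)
open import Data.List.Relation.Unary.Unique.Propositional using (Unique)
open import Data.List.Relation.Unary.Unique.Propositional.Properties using (allFin⁺)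
open import Data.List.Relation.Binary.Permutation.Propositional as ↭ using (_↭_; module PermutationReasoning)
open import Data.List.Relation.Binary.Permutation.Propositional.Properties using (↭-length; ++⁺ʳ; ++⁺ˡ; shift)
open import Data.Maybe using (Maybe; just; nothing; is-just; fromMaybe) renaming (map to mapᴹ)
import Data.Maybe.Properties as MaybeP
open import Data.Product using (Σ; _×_; _,_; proj₁; proj₂)
import Data.Product.Properties as ProductP
open import Data.Sum using (_⊎_; inj₁; inj₂)
open import Data.Empty using (⊥-elim)
open import Data.Vec using (Vec; []; _∷_; lookup)
open import Data.Rational as ℚ using (ℚ; 0ℚ; 1ℚ)
import Data.Rational.Properties as ℚP
open import Function using (_∘_)
open import Function.Bundles using (Equivalence)
open import Relation.Nullary using (¬_; Dec; yes; no; does)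
open import Relation.Nullary.Decidable using (T?; _⊎-dec_)
open import Relation.Binary.Definitions using (tri<; tri≈; tri>)
open import Relation.Binary.PropositionalEquality

T⇒≡true : ∀ {a} → T a → a ≡ true
T⇒≡true = Equivalence.to T-≡

≡true⇒T : ∀ {a} → a ≡ true → T a
≡true⇒T = Equivalence.from T-≡

true≢false : true ≢ false
true≢false ()

∧-trueˡ : ∀ {a b} → a ∧ b ≡ true → a ≡ true
∧-trueˡ {true} _ = refl

∧-trueʳ : ∀ {a b} → a ∧ b ≡ true → b ≡ true
∧-trueʳ {true} e = e

∧-true : ∀ {a b} → a ≡ true → b ≡ true → a ∧ b ≡ true
∧-true refl refl = refl

∨-true⁻ : ∀ {a b} → a ∨ b ≡ true → a ≡ true ⊎ b ≡ true
∨-true⁻ {true} _ = inj₁ refl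
∨-true⁻ {false} e = inj₂ e

∨-trueˡ : ∀ {a b} → a ≡ true → a ∨ b ≡ true
∨-trueˡ refl = refl

∨-trueʳ : ∀ {a b} → b ≡ true → a ∨ b ≡ true
∨-trueʳ {true} _ = refl
∨-trueʳ {false} e = e

Bool-ext : ∀ {a b : Bool} → (a ≡ true → b ≡ true) → (b ≡ true → a ≡ true) → a ≡ b
Bool-ext {true} {true} f g = refl
Bool-ext {true} {false} f g = sym (f refl)
Bool-ext {false} {true} f g = g refl
Bool-ext {false} {false} f g = refl

eqBool⇒≡ : ∀ {a b} → eqBool a b ≡ true → a ≡ b
eqBool⇒≡ {true} {true} _ = refl
eqBool⇒≡ {false} {false} _ = refl

eqBool-refl : ∀ a → eqBool a a ≡ true
eqBool-refl true = refl
eqBool-refl false = refl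

eqBool-≡ : ∀ {a b} → a ≡ b → eqBool a b ≡ true
eqBool-≡ {a} refl = eqBool-refl a

eqPt⇒≡ : ∀ {n} {x y : Pt n} → eqPt x y ≡ true → x ≡ y
eqPt⇒≡ {x = k , b} {l , c} e =
  cong₂ _,_ (FinP.toℕ-injective (ℕP.≡ᵇ⇒≡ _ _ (≡true⇒T (∧-trueˡ e))))
            (eqBool⇒≡ (∧-trueʳ {Fin.toℕ k ≡ᵇ Fin.toℕ l} e))

eqPt-refl : ∀ {n} (x : Pt n) → eqPt x x ≡ true
eqPt-refl (k , b) = ∧-true (T⇒≡true (ℕP.≡⇒≡ᵇ (Fin.toℕ k) (Fin.toℕ k) refl)) (eqBool-refl b)

eqPt-≡ : ∀ {n} {x y : Pt n} → x ≡ y → eqPt x y ≡ true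
eqPt-≡ {x = x} refl = eqPt-refl x

eqMPt⇒≡ : ∀ {n} {x y : Maybe (Pt n)} → eqMPt x y ≡ true → x ≡ y
eqMPt⇒≡ {x = just x} {just y} e = cong just (eqPt⇒≡ e)
eqMPt⇒≡ {x = nothing} {nothing} e = refl

eqMPt-refl : ∀ {n} (x : Maybe (Pt n)) → eqMPt x x ≡ true
eqMPt-refl (just x) = eqPt-refl x
eqMPt-refl nothing = refl

eqMPt-≡ : ∀ {n} {x y : Maybe (Pt n)} → x ≡ y → eqMPt x y ≡ true
eqMPt-≡ {x = x} refl = eqMPt-refl x

eqList-refl : ∀ l → eqList l l ≡ true
eqList-refl [] = refl
eqList-refl (a ∷ l) = ∧-true (T⇒≡true (ℕP.≡⇒≡ᵇ a a refl)) (eqList-refl l)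

allᵇ⁻ : ∀ {A : Set} {p : A → Bool} {xs x} → allᵇ p xs ≡ true → x ∈ xs → p x ≡ true
allᵇ⁻ e (here refl) = ∧-trueˡ e
allᵇ⁻ {p = p} {y ∷ _} e (there m) = allᵇ⁻ (∧-trueʳ {p y} e) m

allᵇ⁺ : ∀ {A : Set} {p : A → Bool} xs → (∀ x → x ∈ xs → p x ≡ true) → allᵇ p xs ≡ true
allᵇ⁺ [] f = refl
allᵇ⁺ (x ∷ xs) f = ∧-true (f x (here refl)) (allᵇ⁺ xs (λ y m → f y (there m)))

anyᵇ⁺ : ∀ {A : Set} {p : A → Bool} {xs x} → x ∈ xs → p x ≡ true → anyᵇ p xs ≡ true
anyᵇ⁺ (here refl) e = ∨-trueˡ e
anyᵇ⁺ {p = p} {y ∷ _} (there m) e = ∨-trueʳ {p y} (anyᵇ⁺ m e)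

anyᵇ⁻ : ∀ {A : Set} {p : A → Bool} xs → anyᵇ p xs ≡ true → Σ A (λ x → x ∈ xs × p x ≡ true)
anyᵇ⁻ {p = p} (y ∷ ys) e with ∨-true⁻ {p y} e
... | inj₁ py = y , here refl , py
... | inj₂ rest with anyᵇ⁻ ys rest
...   | x , m , px = x , there m , px

allᵇ-cong : ∀ {A : Set} {f g : A → Bool} xs → (∀ x → f x ≡ g x) → allᵇ f xs ≡ allᵇ g xs
allᵇ-cong [] h = refl
allᵇ-cong (x ∷ xs) h = cong₂ _∧_ (h x) (allᵇ-cong xs h)

anyᵇ-cong : ∀ {A : Set} {f g : A → Bool} xs → (∀ x → f x ≡ g x) → anyᵇ f xs ≡ anyᵇ g xs
anyᵇ-cong [] h = refl
anyᵇ-cong (x ∷ xs) h = cong₂ _∨_ (h x) (anyᵇ-cong xs h)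

eqRaw-refl : ∀ {n} (σ : Raw n) → eqRaw σ σ ≡ true
eqRaw-refl {n} σ = allᵇ⁺ (allPts n) (λ x _ → eqMPt-refl (σ x))

module _ {A : Set} {p : A → Bool} where

  filterᵇ-accept : ∀ {x} xs → p x ≡ true → filterᵇ p (x ∷ xs) ≡ x ∷ filterᵇ p xs
  filterᵇ-accept xs e = ListP.filter-accept (T? ∘ p) (≡true⇒T e)

  filterᵇ-reject : ∀ {x} xs → p x ≡ false → filterᵇ p (x ∷ xs) ≡ filterᵇ p xs
  filterᵇ-reject xs e = ListP.filter-reject (T? ∘ p) (subst T e)

  ∈-filterᵇ⁺ : ∀ {xs x} → x ∈ xs → p x ≡ true → x ∈ filterᵇ p xs
  ∈-filterᵇ⁺ x∈ e = ∈-filter⁺ (T? ∘ p) x∈ (≡true⇒T e)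

  ∈-filterᵇ⁻ : ∀ {xs x} → x ∈ filterᵇ p xs → x ∈ xs × p x ≡ true
  ∈-filterᵇ⁻ {xs} x∈ = let (x∈xs , px) = ∈-filter⁻ (T? ∘ p) {xs = xs} x∈ in x∈xs , T⇒≡true px

  filterᵇ-none : ∀ xs → (∀ y → y ∈ xs → p y ≡ false) → filterᵇ p xs ≡ []
  filterᵇ-none [] f = refl
  filterᵇ-none (x ∷ xs) f
    rewrite filterᵇ-reject xs (f x (here refl)) = filterᵇ-none xs (λ y m → f y (there m))

  filterᵇ-unique : ∀ {xs b} → Unique xs → b ∈ xs → p b ≡ true →
    (∀ y → p y ≡ true → y ≡ b) → filterᵇ p xs ≡ b ∷ []
  filterᵇ-unique {x ∷ xs} (x∉ ∷ _) (here refl) pb only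
    rewrite filterᵇ-accept xs pb = cong (x ∷_) (filterᵇ-none xs rejected)
    where
    rejected : ∀ y → y ∈ xs → p y ≡ false
    rejected y m with p y in py
    ... | true = ⊥-elim (All¬⇒¬Any x∉ (subst (_∈ xs) (only y py) m))
    ... | false = refl
  filterᵇ-unique {x ∷ xs} (x∉ ∷ u) (there mb) pb only with p x in px
  ... | true = ⊥-elim (All¬⇒¬Any x∉ (subst (_∈ xs) (sym (only x px)) mb))
  ... | false = filterᵇ-unique u mb pb only

  filterᵇ-cong : ∀ {q : A → Bool} xs → (∀ x → p x ≡ q x) → filterᵇ p xs ≡ filterᵇ q xs
  filterᵇ-cong [] h = refl
  filterᵇ-cong {q} (x ∷ xs) h with p x | q x | h x
  ... | true | .true | refl = cong (x ∷_) (filterᵇ-cong xs h)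
  ... | false | .false | refl = filterᵇ-cong xs h

  length-filterᵇ : ∀ xs → length (filterᵇ p xs) ≤ length xs
  length-filterᵇ = ListP.length-filter (T? ∘ p)

_≟ᴾ_ : ∀ {n} (x y : Pt n) → Dec (x ≡ y)
_≟ᴾ_ = ProductP.≡-dec Fin._≟_ _≟ᴮ_

block : ∀ {n} → Fin n → List (Pt n)
block k = (k , false) ∷ (k , true) ∷ []

∈-allPts : ∀ {n} (x : Pt n) → x ∈ allPts n
∈-allPts {n} (k , b) = go (allFin n) b (∈-allFin k)
  where
  go : ∀ ks {k} b → k ∈ ks → (k , b) ∈ concatMap block ks
  go (k ∷ ks) false (here refl) = here refl
  go (k ∷ ks) true (here refl) = there (here refl)
  go (k ∷ ks) b (there m) = there (there (go ks b m))

allPts-unique : ∀ n → Unique (allPts n)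
allPts-unique n = go (allFin n) (allFin⁺ n)
  where
  blockOf : ∀ ks {x : Pt n} → x ∈ concatMap block ks → proj₁ x ∈ ks
  blockOf (k ∷ ks) (here refl) = here refl
  blockOf (k ∷ ks) (there (here refl)) = here refl
  blockOf (k ∷ ks) (there (there m)) = there (blockOf ks m)
  fresh : ∀ ks {k b} → k ∉ ks → All ((k , b) ≢_) (concatMap block ks)
  fresh [] k∉ = []
  fresh (l ∷ ls) k∉ =
    (λ { refl → k∉ (here refl) }) ∷ (λ { refl → k∉ (here refl) }) ∷ fresh ls (k∉ ∘ there)
  go : ∀ ks → Unique ks → Unique (concatMap block ks)
  go [] [] = []
  go (k ∷ ks) (k∉ ∷ u) =
    ((λ ()) ∷ fresh ks (All¬⇒¬Any k∉)) ∷ (fresh ks (All¬⇒¬Any k∉) ∷ go ks u)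

partner-involutive : ∀ {n} (x : Pt n) → partner (partner x) ≡ x
partner-involutive (k , true) = refl
partner-involutive (k , false) = refl

partner-≢ : ∀ {n} (x : Pt n) → partner x ≢ x
partner-≢ (k , true) ()
partner-≢ (k , false) ()

partner-injective : ∀ {n} {x y : Pt n} → partner x ≡ partner y → x ≡ y
partner-injective {x = x} {y} e =
  trans (sym (partner-involutive x)) (trans (cong partner e) (partner-involutive y))

sameBlock : ∀ {n} {x y : Pt n} → proj₁ x ≡ proj₁ y → x ≡ y ⊎ x ≡ partner y
sameBlock {x = k , false} {.k , false} refl = inj₁ refl
sameBlock {x = k , false} {.k , true} refl = inj₂ refl
sameBlock {x = k , true} {.k , false} refl = inj₂ refl
sameBlock {x = k , true} {.k , true} refl = inj₁ refl

idx-injective : ∀ {n} {x y : Pt n} → idx x ≡ idx y → x ≡ y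
idx-injective {x = k , b} {l , c} e = go b c e
  where
  toℕ-eq : 2 * Fin.toℕ k ≡ 2 * Fin.toℕ l → k ≡ l
  toℕ-eq e = FinP.toℕ-injective (ℕP.*-cancelˡ-≡ (Fin.toℕ k) (Fin.toℕ l) 2 e)
  odd≢even : ∀ a b → 2 * a + 1 ≢ 2 * b + 0
  odd≢even a b e = ℕP.0≢1+n (begin
    0                 ≡⟨ sym ([m+kn]%n≡m%n 0 b 2) ⟩
    (0 + b * 2) % 2   ≡⟨ cong (_% 2) (trans (ℕP.*-comm b 2) (sym (ℕP.+-identityʳ (2 * b)))) ⟩
    (2 * b + 0) % 2   ≡⟨ cong (_% 2) (sym e) ⟩
    (2 * a + 1) % 2   ≡⟨ cong (_% 2) (trans (ℕP.+-comm (2 * a) 1) (cong suc (ℕP.*-comm 2 a))) ⟩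
    (1 + a * 2) % 2   ≡⟨ [m+kn]%n≡m%n 1 a 2 ⟩
    1                 ∎)
    where open ≡-Reasoning
  go : ∀ b c → idx (k , b) ≡ idx (l , c) → (k , b) ≡ (l , c)
  go true true e = cong (_, true) (toℕ-eq (ℕP.+-cancelʳ-≡ 1 _ _ e))
  go false false e = cong (_, false) (toℕ-eq (ℕP.+-cancelʳ-≡ 0 _ _ e))
  go true false e = ⊥-elim (odd≢even (Fin.toℕ k) (Fin.toℕ l) e)
  go false true e = ⊥-elim (odd≢even (Fin.toℕ l) (Fin.toℕ k) (sym e))

idx-least : ∀ {n} (q : Pt n → Bool) (L : List (Pt n)) →
  (∀ y → y ∈ L → q y ≡ false) ⊎
  Σ (Pt n) (λ m → m ∈ L × q m ≡ true × (∀ y → y ∈ L → q y ≡ true → idx m ≤ idx y))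
idx-least q [] = inj₁ (λ _ ())
idx-least q (z ∷ L) with q z in qz | idx-least q L
... | false | inj₁ none = inj₁ λ { _ (here refl) → qz ; y (there y∈) → none y y∈ }
... | false | inj₂ (m , m∈ , qm , least) = inj₂ (m , there m∈ , qm ,
      λ { _ (here refl) qy → ⊥-elim (true≢false (trans (sym qy) qz)) ; y (there y∈) qy → least y y∈ qy })
... | true | inj₁ none = inj₂ (z , here refl , qz ,
      λ { _ (here refl) _ → ℕP.≤-refl ; y (there y∈) qy → ⊥-elim (true≢false (trans (sym qy) (none y y∈))) })
... | true | inj₂ (m , m∈ , qm , least) with ℕP.≤-total (idx z) (idx m)
...   | inj₁ z≤m = inj₂ (z , here refl , qz ,
        λ { _ (here refl) _ → ℕP.≤-refl ; y (there y∈) qy → ℕP.≤-trans z≤m (least y y∈ qy) })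
...   | inj₂ m≤z = inj₂ (m , there m∈ , qm , λ { _ (here refl) _ → m≤z ; y (there y∈) qy → least y y∈ qy })

idx-minimum : ∀ {n} (q : Pt n → Bool) (L : List (Pt n)) {x} → x ∈ L → q x ≡ true →
  Σ (Pt n) (λ m → m ∈ L × q m ≡ true × (∀ y → y ∈ L → q y ≡ true → idx m ≤ idx y))
idx-minimum q L x∈ qx with idx-least q L
... | inj₁ none = ⊥-elim (true≢false (trans (sym qx) (none _ x∈)))
... | inj₂ least = least

module _ {n : ℕ} {σ : Raw n} where

  inDom-just : ∀ {x w} → σ x ≡ just w → inDom σ x ≡ true
  inDom-just e rewrite e = refl

  inDom⇒just : ∀ {x} → inDom σ x ≡ true → Σ (Pt n) (λ w → σ x ≡ just w)
  inDom⇒just {x} e with σ x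
  ... | just w = w , refl

  inIm-just : ∀ {x y} → σ x ≡ just y → inIm σ y ≡ true
  inIm-just {x} {y} e = anyᵇ⁺ (∈-allPts x) (eqMPt-≡ e)

  inIm⇒preimage : ∀ {y} → inIm σ y ≡ true → Σ (Pt n) (λ x → σ x ≡ just y)
  inIm⇒preimage e with anyᵇ⁻ (allPts n) e
  ... | x , _ , ex = x , eqMPt⇒≡ ex

record IsPBij {n : ℕ} (σ : Raw n) : Set where
  field
    dom-partner : ∀ x → inDom σ (partner x) ≡ inDom σ x
    im-partner  : ∀ y → inIm σ (partner y) ≡ inIm σ y
    injective   : ∀ {x y w} → σ x ≡ just w → σ y ≡ just w → x ≡ y

  inDom-partner : ∀ {x} → inDom σ x ≡ true → inDom σ (partner x) ≡ true
  inDom-partner {x} d = trans (dom-partner x) d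

module _ {n : ℕ} {σ : Raw n} where

  valid⇒IsPBij : T (valid σ) → IsPBij σ
  valid⇒IsPBij t = record { dom-partner = dom-p ; im-partner = im-p ; injective = inj }
    where
    blockwise : ∀ k → eqBool (inDom σ (k , false)) (inDom σ (k , true))
                    ∧ eqBool (inIm σ (k , false)) (inIm σ (k , true)) ≡ true
    blockwise k = allᵇ⁻ (∧-trueˡ (T⇒≡true t)) (∈-allFin k)
    dom-p : ∀ x → inDom σ (partner x) ≡ inDom σ x
    dom-p (k , false) = sym (eqBool⇒≡ (∧-trueˡ (blockwise k)))
    dom-p (k , true) = eqBool⇒≡ (∧-trueˡ (blockwise k))
    im-p : ∀ y → inIm σ (partner y) ≡ inIm σ y
    im-p (k , false) = sym (eqBool⇒≡ (∧-trueʳ {eqBool (inDom σ (k , false)) _} (blockwise k)))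
    im-p (k , true) = eqBool⇒≡ (∧-trueʳ {eqBool (inDom σ (k , false)) _} (blockwise k))
    inj : ∀ {x y w} → σ x ≡ just w → σ y ≡ just w → x ≡ y
    inj {x} {y} {w} ex ey
      with allᵇ⁻ (allᵇ⁻ (∧-trueʳ {allᵇ _ (allFin n)} (T⇒≡true t)) (∈-allPts x)) (∈-allPts y)
    ... | r rewrite ex | ey | eqPt-refl w = eqPt⇒≡ r

  IsPBij⇒valid : IsPBij σ → T (valid σ)
  IsPBij⇒valid pb = ≡true⇒T (∧-true
    (allᵇ⁺ (allFin n) λ k _ →
      ∧-true (eqBool-≡ (sym (dom-partner (k , false)))) (eqBool-≡ (sym (im-partner (k , false)))))
    (allᵇ⁺ (allPts n) λ x _ → allᵇ⁺ (allPts n) λ y _ → pairwise x y))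
    where
    open IsPBij pb
    pairwise : ∀ x y → (not (inDom σ x ∧ eqMPt (σ x) (σ y)) ∨ eqPt x y) ≡ true
    pairwise x y with σ x in ex | σ y in ey
    ... | nothing | _ = refl
    ... | just a | nothing = refl
    ... | just a | just b with eqPt a b in ab
    ...   | false = refl
    ...   | true = eqPt-≡ (injective ex (trans ey (cong just (sym (eqPt⇒≡ ab)))))

partnerClosed⇒inIm-partner : ∀ {n} {σ : Raw n} (P : Pt n → Set) → (∀ y → inIm σ y ≡ true → P y) →
  (∀ y → P y → inIm σ y ≡ true) → (∀ y → P y → P (partner y)) → ∀ y → inIm σ (partner y) ≡ inIm σ y
partnerClosed⇒inIm-partner P to from P-partner y =
  Bool-ext (λ i → from y (subst P (partner-involutive y) (P-partner _ (to _ i))))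
           (λ i → from _ (P-partner y (to y i)))


findᵇ-just : ∀ {A : Set} {p : A → Bool} {xs x} → x ∈ xs → p x ≡ true →
  Σ A (λ w → findᵇ p xs ≡ just w × p w ≡ true)
findᵇ-just {p = p} {y ∷ ys} x∈ px with p y in py
... | true = y , refl , py
... | false with x∈
...   | here refl = ⊥-elim (true≢false (trans (sym px) py))
...   | there x∈ys = findᵇ-just x∈ys px

module Walk {n : ℕ} {σ : Raw n} (pb : IsPBij σ) where
  open IsPBij pb

  inv-just : ∀ {x y} → σ x ≡ just y → inv σ y ≡ just x
  inv-just {x} {y} e with findᵇ-just {p = λ x → eqMPt (σ x) (just y)} (∈-allPts x) (eqMPt-≡ e)
  ... | w , found , σw≡y = trans found (cong just (injective (eqMPt⇒≡ σw≡y) e))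

  step-just : ∀ {x w y} → σ (partner x) ≡ just w → σ y ≡ just (partner w) → step σ x ≡ just y
  step-just e₁ e₂ rewrite e₁ = inv-just e₂

  next : Pt n → Pt n
  next x = fromMaybe x (step σ x)

  next-spec : ∀ {x} → inDom σ x ≡ true →
    Σ (Pt n) (λ w → σ (partner x) ≡ just w × σ (next x) ≡ just (partner w))
  next-spec {x} d with inDom⇒just {σ = σ} (inDom-partner d)
  ... | w , ew with inIm⇒preimage {σ = σ} {y = partner w} (trans (im-partner w) (inIm-just {σ = σ} ew))
  ...   | y , ey rewrite step-just ew ey = w , ew , ey

  step≡next : ∀ {x} → inDom σ x ≡ true → step σ x ≡ just (next x)
  step≡next d with next-spec d
  ... | w , ew , ey = step-just ew ey

  next-inDom : ∀ {x} → inDom σ x ≡ true → inDom σ (next x) ≡ true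
  next-inDom d with next-spec d
  ... | w , _ , ey = inDom-just {σ = σ} ey

  next-image : ∀ {x w} → inDom σ x ≡ true → σ (partner x) ≡ just w → σ (next x) ≡ just (partner w)
  next-image d e with next-spec d
  ... | w' , ew , ey rewrite MaybeP.just-injective (trans (sym ew) e) = ey

  next-unique : ∀ {x w y} → σ (partner x) ≡ just w → σ y ≡ just (partner w) → next x ≡ y
  next-unique e₁ e₂ rewrite step-just e₁ e₂ = refl

  next-injective : ∀ {x y} → inDom σ x ≡ true → inDom σ y ≡ true → next x ≡ next y → x ≡ y
  next-injective dx dy e with next-spec dx | next-spec dy
  ... | w₁ , e₁ , f₁ | w₂ , e₂ , f₂ = partner-injective (injective e₁ (trans e₂ (cong just w₂≡w₁)))
    where
    w₂≡w₁ : w₂ ≡ w₁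
    w₂≡w₁ = partner-injective (MaybeP.just-injective (trans (sym f₂) (trans (cong σ (sym e)) f₁)))

  next-partner-next : ∀ {x} → inDom σ x ≡ true → next (partner (next x)) ≡ partner x
  next-partner-next {x} d with next-spec d
  ... | w , ew , ey =
    next-unique (subst (λ z → σ z ≡ just (partner w)) (sym (partner-involutive (next x))) ey)
                (subst (λ z → σ (partner x) ≡ just z) (sym (partner-involutive w)) ew)

  next≢partner : ∀ {x} → inDom σ x ≡ true → next x ≢ partner x
  next≢partner {x} d e with next-spec d
  ... | w , ew , ey = partner-≢ w (MaybeP.just-injective (trans (sym ey) (trans (cong σ e) ew)))

  next^ : ℕ → Pt n → Pt n
  next^ zero x = x
  next^ (suc j) x = next (next^ j x)

  next^-inDom : ∀ j {x} → inDom σ x ≡ true → inDom σ (next^ j x) ≡ true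
  next^-inDom zero d = d
  next^-inDom (suc j) d = next-inDom (next^-inDom j d)

  next^-+ : ∀ a b x → next^ (a + b) x ≡ next^ a (next^ b x)
  next^-+ zero b x = refl
  next^-+ (suc a) b x = cong next (next^-+ a b x)

  next^-suc : ∀ j x → next^ (suc j) x ≡ next^ j (next x)
  next^-suc zero x = refl
  next^-suc (suc j) x = cong next (next^-suc j x)

  next^-comm : ∀ a b x → next^ a (next^ b x) ≡ next^ b (next^ a x)
  next^-comm a b x =
    trans (sym (next^-+ a b x)) (trans (cong (λ k → next^ k x) (ℕP.+-comm a b)) (next^-+ b a x))

  next^-injective : ∀ j {x y} → inDom σ x ≡ true → inDom σ y ≡ true → next^ j x ≡ next^ j y → x ≡ y
  next^-injective zero dx dy e = e
  next^-injective (suc j) dx dy e =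
    next^-injective j dx dy (next-injective (next^-inDom j dx) (next^-inDom j dy) e)

  next^-partner-next^ : ∀ j {x} → inDom σ x ≡ true → next^ j (partner (next^ j x)) ≡ partner x
  next^-partner-next^ zero d = refl
  next^-partner-next^ (suc j) {x} d = begin
    next^ (suc j) (partner (next (next^ j x)))   ≡⟨ next^-suc j _ ⟩
    next^ j (next (partner (next (next^ j x))))  ≡⟨ cong (next^ j) (next-partner-next (next^-inDom j d)) ⟩
    next^ j (partner (next^ j x))                ≡⟨ next^-partner-next^ j d ⟩
    partner x                                    ∎
    where open ≡-Reasoning

  iter≡next^ : ∀ j {x} → inDom σ x ≡ true → iter σ j x ≡ just (next^ j x)
  iter≡next^ zero d = refl
  iter≡next^ (suc j) d rewrite iter≡next^ j d = step≡next (next^-inDom j d)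

≤ᵇ-trans : ∀ a b c → (a ≤ᵇ b) ≡ true → (b ≤ᵇ c) ≡ true → (a ≤ᵇ c) ≡ true
≤ᵇ-trans a b c p q =
  T⇒≡true (ℕP.≤⇒≤ᵇ (ℕP.≤-trans (ℕP.≤ᵇ⇒≤ a b (≡true⇒T p)) (ℕP.≤ᵇ⇒≤ b c (≡true⇒T q))))

≤ᵇ-total : ∀ a b → (a ≤ᵇ b) ≡ false → (b ≤ᵇ a) ≡ true
≤ᵇ-total a b p with ℕP.≤-total b a
... | inj₁ b≤a = T⇒≡true (ℕP.≤⇒≤ᵇ b≤a)
... | inj₂ a≤b = ⊥-elim (true≢false (trans (sym (T⇒≡true (ℕP.≤⇒≤ᵇ a≤b))) p))

≤ᵇ-antisym : ∀ a b → (a ≤ᵇ b) ≡ true → (b ≤ᵇ a) ≡ true → a ≡ b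
≤ᵇ-antisym a b p q = ℕP.≤-antisym (ℕP.≤ᵇ⇒≤ a b (≡true⇒T p)) (ℕP.≤ᵇ⇒≤ b a (≡true⇒T q))

insertDesc-comm : ∀ a b l → insertDesc a (insertDesc b l) ≡ insertDesc b (insertDesc a l)
insertDesc-comm a b [] with b ≤ᵇ a in ba | a ≤ᵇ b in ab
... | true  | true  = cong₂ (λ x y → x ∷ y ∷ []) (≤ᵇ-antisym a b ab ba) (sym (≤ᵇ-antisym a b ab ba))
... | true  | false = refl
... | false | true  = refl
... | false | false = ⊥-elim (true≢false (trans (sym (≤ᵇ-total b a ba)) ab))
insertDesc-comm a b (c ∷ cs) with c ≤ᵇ b in cb | c ≤ᵇ a in ca
... | true | true with b ≤ᵇ a in ba | a ≤ᵇ b in ab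
...   | true  | true  = cong₂ (λ x y → x ∷ y ∷ c ∷ cs) (≤ᵇ-antisym a b ab ba) (sym (≤ᵇ-antisym a b ab ba))
...   | true  | false rewrite cb = refl
...   | false | true  rewrite ca = refl
...   | false | false = ⊥-elim (true≢false (trans (sym (≤ᵇ-total b a ba)) ab))
insertDesc-comm a b (c ∷ cs) | true | false with b ≤ᵇ a in ba
...   | true  = ⊥-elim (true≢false (trans (sym (≤ᵇ-trans c b a cb ba)) ca))
...   | false rewrite ca | cb = refl
insertDesc-comm a b (c ∷ cs) | false | true with a ≤ᵇ b in ab
...   | true  = ⊥-elim (true≢false (trans (sym (≤ᵇ-trans c a b ca ab)) cb))
...   | false rewrite ca | cb = refl
insertDesc-comm a b (c ∷ cs) | false | false rewrite ca | cb = cong (c ∷_) (insertDesc-comm a b cs)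

sortDesc-cong-↭ : ∀ {xs ys} → xs ↭ ys → sortDesc xs ≡ sortDesc ys
sortDesc-cong-↭ ↭.refl = refl
sortDesc-cong-↭ (↭.prep x p) = cong (insertDesc x) (sortDesc-cong-↭ p)
sortDesc-cong-↭ (↭.swap {ys = ys} x y p) =
  trans (cong (λ l → insertDesc x (insertDesc y l)) (sortDesc-cong-↭ p)) (insertDesc-comm x y (sortDesc ys))
sortDesc-cong-↭ (↭.trans p q) = trans (sortDesc-cong-↭ p) (sortDesc-cong-↭ q)

insertDesc-↭ : ∀ a l → insertDesc a l ↭ a ∷ l
insertDesc-↭ a [] = ↭.refl
insertDesc-↭ a (c ∷ cs) with c ≤ᵇ a
... | true = ↭.refl
... | false = ↭.trans (↭.prep c (insertDesc-↭ a cs)) (↭.swap c a ↭.refl)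

sortDesc-↭ : ∀ xs → sortDesc xs ↭ xs
sortDesc-↭ [] = ↭.refl
sortDesc-↭ (x ∷ xs) = ↭.trans (insertDesc-↭ x (sortDesc xs)) (↭.prep x (sortDesc-↭ xs))

length-sortDesc : ∀ xs → length (sortDesc xs) ≡ length xs
length-sortDesc xs = ↭-length (sortDesc-↭ xs)

sortDesc-sortDesc-++ : ∀ xs ys → sortDesc (sortDesc xs ++ ys) ≡ sortDesc (xs ++ ys)
sortDesc-sortDesc-++ xs ys = sortDesc-cong-↭ (++⁺ʳ ys (sortDesc-↭ xs))

search : (ℕ → Bool) → ℕ → List ℕ → ℕ
search f d [] = d
search f d (m ∷ ms) = if f m then m else search f d ms

search-++ : ∀ f d xs ys → search f d (xs ++ ys) ≡ search f (search f d ys) xs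
search-++ f d [] ys = refl
search-++ f d (x ∷ xs) ys rewrite search-++ f d xs ys = refl

search-cong : ∀ {f g : ℕ → Bool} d ms → (∀ m → f m ≡ g m) → search f d ms ≡ search g d ms
search-cong d [] h = refl
search-cong {f} {g} d (m ∷ ms) h rewrite h m | search-cong {f} {g} d ms h = refl

data SearchResult (f : ℕ → Bool) (d N r : ℕ) : Set where
  miss : (∀ j → 1 ≤ j → j ≤ N → f j ≡ false) → r ≡ d → SearchResult f d N r
  hit  : f r ≡ true → 1 ≤ r → r ≤ N → (∀ j → 1 ≤ j → j < r → f j ≡ false) → SearchResult f d N r

search-range1 : ∀ f d N → SearchResult f d N (search f d (range1 N))
search-range1 f d zero = miss (λ { .zero () z≤n }) refl
search-range1 f d (suc N) rewrite search-++ f d (range1 N) (suc N ∷ []) with f (suc N) in fN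
... | true with search-range1 f (suc N) N
...   | miss none r≡N+1 rewrite r≡N+1 =
          hit fN (s≤s z≤n) ℕP.≤-refl (λ j 1≤j j<N+1 → none j 1≤j (ℕP.≤-pred j<N+1))
...   | hit fr 1≤r r≤N first = hit fr 1≤r (ℕP.m≤n⇒m≤1+n r≤N) first
search-range1 f d (suc N) | false with search-range1 f d N
...   | miss none r≡d = miss extend r≡d
  where
  extend : ∀ j → 1 ≤ j → j ≤ suc N → f j ≡ false
  extend j 1≤j j≤N+1 with ℕP.m≤n⇒m<n∨m≡n j≤N+1
  ... | inj₁ j<N+1 = none j 1≤j (ℕP.≤-pred j<N+1)
  ... | inj₂ refl = fN
...   | hit fr 1≤r r≤N first = hit fr 1≤r (ℕP.m≤n⇒m≤1+n r≤N) first

∈-range1 : ∀ N j → 1 ≤ j → j ≤ N → j ∈ range1 N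
∈-range1 zero .zero () z≤n
∈-range1 (suc N) j 1≤j j≤N+1 with ℕP.m≤n⇒m<n∨m≡n j≤N+1
... | inj₁ j<N+1 = ∈-++⁺ˡ (∈-range1 N j 1≤j (ℕP.≤-pred j<N+1))
... | inj₂ refl = ∈-++⁺ʳ (range1 N) (here refl)

returnsAt : ∀ {n} → Raw n → Pt n → ℕ → Bool
returnsAt σ x m = eqMPt (iter σ m x) (just x)

orbSize≡search : ∀ {n} (σ : Raw n) x → orbSize σ x ≡ search (returnsAt σ x) 0 (range1 (2 * n))
orbSize≡search {n} σ x = go (range1 (2 * n))
  where
  go : ∀ ms → orbSizeFrom σ x 0 ms ≡ search (returnsAt σ x) 0 ms
  go [] = refl
  go (m ∷ ms) rewrite go ms = refl

open Walk

module _ {n : ℕ} {σ : Raw n} (pb : IsPBij σ) where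
  open IsPBij pb

  record MinPeriod (x : Pt n) (μ : ℕ) : Set where
    field
      returns : next^ pb μ x ≡ x
      minimal : ∀ j → 1 ≤ j → j < μ → next^ pb j x ≢ x

  returnsAt-true : ∀ {x} j → inDom σ x ≡ true → next^ pb j x ≡ x → returnsAt σ x j ≡ true
  returnsAt-true {x} j d e rewrite iter≡next^ pb j d | e = eqPt-refl x

  returnsAt-true⁻ : ∀ {x} j → inDom σ x ≡ true → returnsAt σ x j ≡ true → next^ pb j x ≡ x
  returnsAt-true⁻ j d e rewrite iter≡next^ pb j d = MaybeP.just-injective (eqMPt⇒≡ e)

  orbSize≡minPeriod : ∀ {x μ} → inDom σ x ≡ true → MinPeriod x μ → 1 ≤ μ → μ ≤ 2 * n → orbSize σ x ≡ μ
  orbSize≡minPeriod {x} {μ} d mp 1≤μ μ≤2n rewrite orbSize≡search σ x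
    with search (returnsAt σ x) 0 (range1 (2 * n)) | search-range1 (returnsAt σ x) 0 (2 * n)
  ... | r | miss none _ = ⊥-elim (true≢false (trans (sym (returnsAt-true μ d returns)) (none μ 1≤μ μ≤2n)))
    where open MinPeriod mp
  ... | r | hit fr 1≤r _ first with ℕP.<-cmp r μ
  ...   | tri< r<μ _ _ = ⊥-elim (MinPeriod.minimal mp r 1≤r r<μ (returnsAt-true⁻ r d fr))
  ...   | tri≈ _ r≡μ _ = r≡μ
  ...   | tri> _ _ μ<r =
            ⊥-elim (true≢false (trans (sym (returnsAt-true μ d (MinPeriod.returns mp))) (first μ 1≤μ μ<r)))

  orbSize-minPeriod : ∀ {x μ} → inDom σ x ≡ true → orbSize σ x ≡ μ → 1 ≤ μ → MinPeriod x μ × μ ≤ 2 * n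
  orbSize-minPeriod {x} {μ} d os 1≤μ rewrite orbSize≡search σ x
    with search (returnsAt σ x) 0 (range1 (2 * n)) | search-range1 (returnsAt σ x) 0 (2 * n)
  ... | r | miss _ r≡0 = ⊥-elim (ℕP.<⇒≢ 1≤μ (sym (trans (sym os) r≡0)))
  ... | r | hit fr _ r≤2n first rewrite os =
    record { returns = returnsAt-true⁻ μ d fr
           ; minimal = λ j 1≤j j<μ ret → true≢false (trans (sym (returnsAt-true j d ret)) (first j 1≤j j<μ)) }
    , r≤2n

  onCycle⇒reachable : ∀ {x y} → inDom σ x ≡ true → onCycle σ x y ≡ true →
    Σ ℕ (λ j → next^ pb j x ≡ y ⊎ next^ pb j (partner x) ≡ y)
  onCycle⇒reachable {x} {y} d oc with anyᵇ⁻ (0 ∷ range1 (2 * n)) oc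
  ... | j , _ , found with ∨-true⁻ {eqMPt (iter σ j x) (just y)} found
  ...   | inj₁ h rewrite iter≡next^ pb j d = j , inj₁ (MaybeP.just-injective (eqMPt⇒≡ h))
  ...   | inj₂ h rewrite iter≡next^ pb j (inDom-partner d) = j , inj₂ (MaybeP.just-injective (eqMPt⇒≡ h))

  reachable⇒onCycle : ∀ {x y} j → inDom σ x ≡ true → j ≤ 2 * n →
    next^ pb j x ≡ y ⊎ next^ pb j (partner x) ≡ y → onCycle σ x y ≡ true
  reachable⇒onCycle {x} {y} j d j≤2n reach = anyᵇ⁺ (∈-0∷range1 j j≤2n) (witness reach)
    where
    ∈-0∷range1 : ∀ j → j ≤ 2 * n → j ∈ (0 ∷ range1 (2 * n))
    ∈-0∷range1 zero _ = here refl
    ∈-0∷range1 (suc j) j≤2n = there (∈-range1 (2 * n) (suc j) (s≤s z≤n) j≤2n)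
    witness : next^ pb j x ≡ y ⊎ next^ pb j (partner x) ≡ y →
      (eqMPt (iter σ j x) (just y) ∨ eqMPt (iter σ j (partner x)) (just y)) ≡ true
    witness (inj₁ e) rewrite iter≡next^ pb j d | e = ∨-trueˡ (eqPt-refl y)
    witness (inj₂ e) rewrite iter≡next^ pb j (inDom-partner d) | e =
      ∨-trueʳ {eqMPt (iter σ j x) (just y)} (eqPt-refl y)

  onCycle-inDom : ∀ {x y} → inDom σ x ≡ true → onCycle σ x y ≡ true → inDom σ y ≡ true
  onCycle-inDom d oc with onCycle⇒reachable d oc
  ... | j , inj₁ e = subst (λ z → inDom σ z ≡ true) e (next^-inDom pb j d)
  ... | j , inj₂ e = subst (λ z → inDom σ z ≡ true) e (next^-inDom pb j (inDom-partner d))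

  isRep⇒least : ∀ {x} → isRep σ x ≡ true →
    inDom σ x ≡ true × (∀ y → onCycle σ x y ≡ true → idx x ≤ idx y)
  isRep⇒least {x} r = ∧-trueˡ r , λ y oc →
    ℕP.≤ᵇ⇒≤ _ _ (≡true⇒T (implies (allᵇ⁻ (∧-trueʳ {inDom σ x} r) (∈-allPts y)) oc))
    where
    implies : ∀ {a b} → (not a ∨ b) ≡ true → a ≡ true → b ≡ true
    implies {true} e refl = e

  least⇒isRep : ∀ {x} → inDom σ x ≡ true → (∀ y → onCycle σ x y ≡ true → idx x ≤ idx y) → isRep σ x ≡ true
  least⇒isRep {x} d least = ∧-true d (allᵇ⁺ (allPts n) (λ y _ → implies y))
    where
    implies : ∀ y → (not (onCycle σ x y) ∨ (idx x ≤ᵇ idx y)) ≡ true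
    implies y with onCycle σ x y in oc
    ... | false = refl
    ... | true = T⇒≡true (ℕP.≤⇒≤ᵇ (least y oc))

  minPeriod-next^ : ∀ {x μ} i → inDom σ x ≡ true → MinPeriod x μ → MinPeriod (next^ pb i x) μ
  minPeriod-next^ {x} {μ} i d mp = record
    { returns = trans (next^-comm pb μ i x) (cong (next^ pb i) returns)
    ; minimal = λ j 1≤j j<μ e →
        minimal j 1≤j j<μ (next^-injective pb i (next^-inDom pb j d) d (trans (next^-comm pb i j x) e)) }
    where open MinPeriod mp

  minPeriod-partner : ∀ {x μ} → inDom σ x ≡ true → MinPeriod x μ → MinPeriod (partner x) μ
  minPeriod-partner {x} {μ} d mp = record
    { returns = subst (λ z → next^ pb μ (partner z) ≡ partner x) returns (next^-partner-next^ pb μ d)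
    ; minimal = λ j 1≤j j<μ e → minimal j 1≤j j<μ (partner-injective
        (next^-injective pb j (inDom-partner (next^-inDom pb j d)) (inDom-partner d)
          (trans (next^-partner-next^ pb j d) (sym e)))) }
    where open MinPeriod mp

  next^-multiple : ∀ {x μ} → MinPeriod x μ → ∀ q → next^ pb (q * μ) x ≡ x
  next^-multiple mp zero = refl
  next^-multiple {x} {μ} mp (suc q) =
    trans (next^-+ pb μ (q * μ) x) (trans (cong (next^ pb μ) (next^-multiple mp q)) (MinPeriod.returns mp))

  next^-mod : ∀ {x μ} → MinPeriod x (suc μ) → ∀ j → next^ pb j x ≡ next^ pb (j % suc μ) x
  next^-mod {x} {μ} mp j = begin
    next^ pb j x                                               ≡⟨ cong (λ k → next^ pb k x) (m≡m%n+[m/n]*n j (suc μ)) ⟩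
    next^ pb (j % suc μ + (j / suc μ) * suc μ) x               ≡⟨ next^-+ pb (j % suc μ) _ x ⟩
    next^ pb (j % suc μ) (next^ pb ((j / suc μ) * suc μ) x)    ≡⟨ cong (next^ pb (j % suc μ)) (next^-multiple mp (j / suc μ)) ⟩
    next^ pb (j % suc μ) x                                     ∎
    where open ≡-Reasoning

  -- partner conjugates g to g⁻¹, and g⁻¹ = g^μ on an orbit of period μ + 1.
  partner-next^ : ∀ {x μ} → inDom σ x ≡ true → MinPeriod x (suc μ) →
    ∀ i → partner (next^ pb i x) ≡ next^ pb (i * μ) (partner x)
  partner-next^ {x} {μ} d mp i =
    next^-injective pb i (inDom-partner (next^-inDom pb i d)) (next^-inDom pb (i * μ) (inDom-partner d))
      (trans (next^-partner-next^ pb i d) (sym (begin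
        next^ pb i (next^ pb (i * μ) (partner x))   ≡⟨ next^-+ pb i (i * μ) (partner x) ⟨
        next^ pb (i + i * μ) (partner x)            ≡⟨ cong (λ k → next^ pb k (partner x)) (ℕP.*-suc i μ) ⟨
        next^ pb (i * suc μ) (partner x)            ≡⟨ next^-multiple (minPeriod-partner d mp) i ⟩
        partner x                                   ∎)))
    where open ≡-Reasoning

  next^-reach : ∀ {c μ} → inDom σ c ≡ true → MinPeriod c (suc μ) → suc μ ≤ 2 * n → ∀ i k →
    Σ ℕ (λ j → j ≤ 2 * n × next^ pb j (next^ pb i c) ≡ next^ pb k c)
  next^-reach {c} {μ} d mp μ+1≤2n i k =
    a % suc μ , ℕP.≤-trans (ℕP.<⇒≤ (m%n<n a (suc μ))) μ+1≤2n ,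
    trans (sym (next^-mod (minPeriod-next^ i d mp) a)) (begin
      next^ pb (k + i * μ) (next^ pb i c)         ≡⟨ next^-+ pb k (i * μ) _ ⟩
      next^ pb k (next^ pb (i * μ) (next^ pb i c)) ≡⟨ cong (next^ pb k) (next^-+ pb (i * μ) i c) ⟨
      next^ pb k (next^ pb (i * μ + i) c)          ≡⟨ cong (λ z → next^ pb k (next^ pb z c)) i*μ+i≡i*[1+μ] ⟩
      next^ pb k (next^ pb (i * suc μ) c)          ≡⟨ cong (next^ pb k) (next^-multiple mp i) ⟩
      next^ pb k c                                 ∎)
    where
    open ≡-Reasoning
    a : ℕ
    a = k + i * μ
    i*μ+i≡i*[1+μ] : i * μ + i ≡ i * suc μ
    i*μ+i≡i*[1+μ] = trans (ℕP.+-comm (i * μ) i) (sym (ℕP.*-suc i μ))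

  next^-distinct : ∀ {x μ} → inDom σ x ≡ true → MinPeriod x μ →
    ∀ {a b} → a < b → b < μ → next^ pb a x ≢ next^ pb b x
  next^-distinct {x} d mp {a} {b} a<b b<μ e =
    MinPeriod.minimal mp (b ∸ a) (ℕP.m<n⇒0<n∸m a<b) (ℕP.≤-<-trans (ℕP.m∸n≤m b a) b<μ)
      (sym (next^-injective pb a d (next^-inDom pb (b ∸ a) d) (trans e (begin
        next^ pb b x                  ≡⟨ cong (λ t → next^ pb t x) (ℕP.m+[n∸m]≡n (ℕP.<⇒≤ a<b)) ⟨
        next^ pb (a + (b ∸ a)) x      ≡⟨ next^-+ pb a (b ∸ a) x ⟩
        next^ pb a (next^ pb (b ∸ a) x) ∎))))
    where open ≡-Reasoning

  minPeriod-injective : ∀ {x μ} → inDom σ x ≡ true → MinPeriod x μ →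
    ∀ {i j} → i < μ → j < μ → next^ pb i x ≡ next^ pb j x → i ≡ j
  minPeriod-injective d mp {i} {j} i<μ j<μ e with ℕP.<-cmp i j
  ... | tri≈ _ i≡j _ = i≡j
  ... | tri< i<j _ _ = ⊥-elim (next^-distinct d mp i<j j<μ e)
  ... | tri> _ _ j<i = ⊥-elim (next^-distinct d mp j<i i<μ (sym e))

  -- The graph of σ is a single cycle of length 2(μ + 1) through b.
  record SingleCycle (b : Pt n) (μ : ℕ) : Set where
    field
      inDom-base : inDom σ b ≡ true
      length≤    : suc μ ≤ 2 * n
      period     : MinPeriod b (suc μ)
      covers     : ∀ y → inDom σ y ≡ true → Σ ℕ (λ j → y ≡ next^ pb j b ⊎ y ≡ next^ pb j (partner b))

  module _ {b μ} (sc : SingleCycle b μ) where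
    open SingleCycle sc

    covers⇒minPeriod : ∀ y → inDom σ y ≡ true → MinPeriod y (suc μ)
    covers⇒minPeriod y d with covers y d
    ... | j , inj₁ refl = minPeriod-next^ j inDom-base period
    ... | j , inj₂ refl = minPeriod-next^ j (inDom-partner inDom-base) (minPeriod-partner inDom-base period)

    onCycle-any : ∀ x y → inDom σ x ≡ true → inDom σ y ≡ true → onCycle σ x y ≡ true
    onCycle-any x y dx dy with covers x dx | covers y dy
    ... | i , inj₁ refl | k , inj₁ refl with next^-reach inDom-base period length≤ i k
    ...   | j , j≤ , e = reachable⇒onCycle j dx j≤ (inj₁ e)
    onCycle-any x y dx dy | i , inj₂ refl | k , inj₂ refl
      with next^-reach (inDom-partner inDom-base) (minPeriod-partner inDom-base period) length≤ i k
    ...   | j , j≤ , e = reachable⇒onCycle j dx j≤ (inj₁ e)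
    onCycle-any x y dx dy | i , inj₁ refl | k , inj₂ refl
      with next^-reach (inDom-partner inDom-base) (minPeriod-partner inDom-base period) length≤ (i * μ) k
    ...   | j , j≤ , e = reachable⇒onCycle j dx j≤
            (inj₂ (trans (cong (next^ pb j) (partner-next^ inDom-base period i)) e))
    onCycle-any x y dx dy | i , inj₂ refl | k , inj₁ refl
      with next^-reach inDom-base period length≤ (i * μ) k
    ...   | j , j≤ , e = reachable⇒onCycle j dx j≤ (inj₂ (trans (cong (next^ pb j) partner-x) e))
      where
      partner-x : partner (next^ pb i (partner b)) ≡ next^ pb (i * μ) b
      partner-x = trans (partner-next^ (inDom-partner inDom-base) (minPeriod-partner inDom-base period) i)
                        (cong (next^ pb (i * μ)) (partner-involutive b))

    singleCycle⇒ct : ct σ ≡ suc μ ∷ []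
    singleCycle⇒ct with idx-minimum (inDom σ) (allPts n) (∈-allPts b) inDom-base
    ... | r , r∈ , dr , least = begin
      ct σ                         ≡⟨ cong (sortDesc ∘ map (orbSize σ)) (filterᵇ-unique (allPts-unique n) r∈ r-isRep r-only) ⟩
      orbSize σ r ∷ []             ≡⟨ cong (_∷ []) (orbSize≡minPeriod dr (covers⇒minPeriod r dr) (s≤s z≤n) length≤) ⟩
      suc μ ∷ []                   ∎
      where
      open ≡-Reasoning
      r-isRep : isRep σ r ≡ true
      r-isRep = least⇒isRep dr (λ y oc → least y (∈-allPts y) (onCycle-inDom dr oc))
      r-only : ∀ y → isRep σ y ≡ true → y ≡ r
      r-only y ry with isRep⇒least ry
      ... | dy , y-least = idx-injective (ℕP.≤-antisym (y-least r (onCycle-any y r dy dr))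
                                                       (least y (∈-allPts y) dy))

  -- Conversely, if b is the only cycle representative, the orbits of b and of its partner
  -- exhaust the domain: the least point outside them would be a second representative.
  module _ {b μ} (db : inDom σ b ≡ true) (mp : MinPeriod b (suc μ)) where

    OnOrbit : Pt n → Set
    OnOrbit y = Σ ℕ (λ j → y ≡ next^ pb j b ⊎ y ≡ next^ pb j (partner b))

    OnOrbit< : Pt n → Set
    OnOrbit< y = Σ ℕ (λ j → j < suc μ × (y ≡ next^ pb j b ⊎ y ≡ next^ pb j (partner b)))

    onOrbit<? : ∀ y → Dec (OnOrbit< y)
    onOrbit<? y = ℕP.anyUpTo? (λ j → (y ≟ᴾ next^ pb j b) ⊎-dec (y ≟ᴾ next^ pb j (partner b))) (suc μ)

    onOrbit⇒onOrbit< : ∀ {y} → OnOrbit y → OnOrbit< y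
    onOrbit⇒onOrbit< (j , inj₁ e) = j % suc μ , m%n<n j (suc μ) , inj₁ (trans e (next^-mod mp j))
    onOrbit⇒onOrbit< (j , inj₂ e) =
      j % suc μ , m%n<n j (suc μ) , inj₂ (trans e (next^-mod (minPeriod-partner db mp) j))

    onOrbit<⇒onOrbit : ∀ {y} → OnOrbit< y → OnOrbit y
    onOrbit<⇒onOrbit (j , _ , e) = j , e

    next^-back : ∀ {c} → MinPeriod c (suc μ) → ∀ k → next^ pb k c ≡ next pb (next^ pb (k + μ) c)
    next^-back {c} mpc k = sym (begin
      next^ pb (suc (k + μ)) c        ≡⟨ cong (λ z → next^ pb z c) (ℕP.+-suc k μ) ⟨
      next^ pb (k + suc μ) c          ≡⟨ next^-+ pb k (suc μ) c ⟩
      next^ pb k (next^ pb (suc μ) c) ≡⟨ cong (next^ pb k) (MinPeriod.returns mpc) ⟩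
      next^ pb k c                    ∎)
      where open ≡-Reasoning

    onOrbit-next⁻ : ∀ {y} → inDom σ y ≡ true → OnOrbit (next pb y) → OnOrbit y
    onOrbit-next⁻ d (k , inj₁ e) =
      k + μ , inj₁ (next-injective pb d (next^-inDom pb (k + μ) db) (trans e (next^-back mp k)))
    onOrbit-next⁻ d (k , inj₂ e) =
      k + μ , inj₂ (next-injective pb d (next^-inDom pb (k + μ) (inDom-partner db))
                      (trans e (next^-back (minPeriod-partner db mp) k)))

    onOrbit-next^⁻ : ∀ j {y} → inDom σ y ≡ true → OnOrbit (next^ pb j y) → OnOrbit y
    onOrbit-next^⁻ zero d o = o
    onOrbit-next^⁻ (suc j) d o = onOrbit-next^⁻ j d (onOrbit-next⁻ (next^-inDom pb j d) o)

    onOrbit-partner⁻ : ∀ {y} → OnOrbit (partner y) → OnOrbit y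
    onOrbit-partner⁻ {y} (k , inj₁ e) =
      k * μ , inj₂ (trans (sym (partner-involutive y)) (trans (cong partner e) (partner-next^ db mp k)))
    onOrbit-partner⁻ {y} (k , inj₂ e) =
      k * μ , inj₁ (trans (sym (partner-involutive y)) (trans (cong partner e)
        (trans (partner-next^ (inDom-partner db) (minPeriod-partner db mp) k)
               (cong (next^ pb (k * μ)) (partner-involutive b)))))

    outside : Pt n → Bool
    outside y = inDom σ y ∧ not (does (onOrbit<? y))

    outside-false : ∀ {y} → inDom σ y ≡ true → outside y ≡ false → OnOrbit< y
    outside-false {y} d e with onOrbit<? y
    ... | yes o = o
    ... | no _ rewrite d = ⊥-elim (true≢false e)

    outside-true : ∀ {y} → outside y ≡ true → ¬ OnOrbit< y
    outside-true {y} e o with onOrbit<? y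
    ... | yes _ rewrite ∧-zeroʳ (inDom σ y) = true≢false (sym e)
    ... | no ¬o = ¬o o

    soleRep⇒covers : filterᵇ (isRep σ) (allPts n) ≡ b ∷ [] → ∀ y → inDom σ y ≡ true → OnOrbit y
    soleRep⇒covers reps y dy with onOrbit<? y
    ... | yes o = onOrbit<⇒onOrbit o
    ... | no ¬o with idx-minimum outside (allPts n) (∈-allPts y) outside-y
      where
      outside-y : outside y ≡ true
      outside-y rewrite dy with onOrbit<? y
      ... | yes o = ⊥-elim (¬o o)
      ... | no _ = refl
    ...   | w , _ , ow , least = ⊥-elim (outside-true ow (subst OnOrbit< (sym w≡b) (0 , s≤s z≤n , inj₁ refl)))
      where
      dw : inDom σ w ≡ true
      dw = ∧-trueˡ ow
      onCycle-w : ∀ y' → onCycle σ w y' ≡ true → idx w ≤ idx y'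
      onCycle-w y' oc with outside y' in o'
      ... | true = least y' (∈-allPts y') o'
      ... | false with onCycle⇒reachable dw oc | onOrbit<⇒onOrbit (outside-false (onCycle-inDom dw oc) o')
      ...   | j , inj₁ e | o = ⊥-elim (outside-true ow (onOrbit⇒onOrbit< (onOrbit-next^⁻ j dw (subst OnOrbit (sym e) o))))
      ...   | j , inj₂ e | o = ⊥-elim (outside-true ow (onOrbit⇒onOrbit<
              (onOrbit-partner⁻ (onOrbit-next^⁻ j (inDom-partner dw) (subst OnOrbit (sym e) o)))))
      w≡b : w ≡ b
      w≡b with subst (w ∈_) reps (∈-filterᵇ⁺ (∈-allPts w) (least⇒isRep dw onCycle-w))
      ... | here e = e

  ct⇒singleCycle : ∀ {μ} → ct σ ≡ suc μ ∷ [] → Σ (Pt n) (λ b → SingleCycle b μ)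
  ct⇒singleCycle {μ} e = go (filterᵇ (isRep σ) (allPts n)) refl e
    where
    go : ∀ L → filterᵇ (isRep σ) (allPts n) ≡ L → sortDesc (map (orbSize σ) L) ≡ suc μ ∷ [] →
      Σ (Pt n) (λ b → SingleCycle b μ)
    go [] _ ()
    go (b ∷ c ∷ rest) _ e' with trans (sym (length-sortDesc (map (orbSize σ) (b ∷ c ∷ rest)))) (cong length e')
    ... | ()
    go (b ∷ []) reps e' =
      b , record { inDom-base = db ; length≤ = proj₂ mp ; period = proj₁ mp ; covers = soleRep⇒covers db (proj₁ mp) reps }
      where
      db : inDom σ b ≡ true
      db = ∧-trueˡ (proj₂ (∈-filterᵇ⁻ {xs = allPts n} (subst (b ∈_) (sym reps) (here refl))))
      mp : MinPeriod b (suc μ) × suc μ ≤ 2 * n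
      mp = orbSize-minPeriod db (ListP.∷-injectiveˡ e') (s≤s z≤n)

-- Extending by blocks on which g is the identity adds parts equal to 1

map-filterᵇ-cong : ∀ {A B : Set} {p q : A → Bool} {f g : A → B} xs →
  (∀ x → x ∈ xs → p x ≡ q x) → (∀ x → x ∈ xs → f x ≡ g x) → map f (filterᵇ p xs) ≡ map g (filterᵇ q xs)
map-filterᵇ-cong [] hp hf = refl
map-filterᵇ-cong {p = p} {q} (x ∷ xs) hp hf with p x | q x | hp x (here refl)
... | true | .true | refl =
  cong₂ _∷_ (hf x (here refl)) (map-filterᵇ-cong xs (λ y m → hp y (there m)) (λ y m → hf y (there m)))
... | false | .false | refl = map-filterᵇ-cong xs (λ y m → hp y (there m)) (λ y m → hf y (there m))

++-replicate-cong : ∀ {l l' : List ℕ} {m m'} → l ≡ l' → m ≡ m' → l ++ replicate m 1 ≡ l' ++ replicate m' 1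
++-replicate-cong = cong₂ (λ l m → l ++ replicate m 1)

1≤2*n : ∀ {n} → Pt n → 1 ≤ 2 * n
1≤2*n {suc n} _ = s≤s z≤n

module TrivialExtension {n : ℕ} {σ σ̃ : Raw n} (pb : IsPBij σ) (p̃b : IsPBij σ̃)
  (agrees : ∀ x → inDom σ x ≡ true → σ̃ x ≡ σ x)
  (new-blocks : ∀ x w → inDom σ x ≡ false → σ̃ x ≡ just w → σ̃ (partner x) ≡ just (partner w)) where

  open IsPBij

  inDom-extends : ∀ {x} → inDom σ x ≡ true → inDom σ̃ x ≡ true
  inDom-extends {x} d = trans (cong is-just (agrees x d)) d

  next-old : ∀ {x} → inDom σ x ≡ true → next p̃b x ≡ next pb x
  next-old {x} d with next-spec pb d
  ... | w , e₁ , e₂ = next-unique p̃b (trans (agrees (partner x) (inDom-partner pb d)) e₁)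
                                     (trans (agrees (next pb x) (next-inDom pb d)) e₂)

  next^-old : ∀ j {x} → inDom σ x ≡ true → next^ p̃b j x ≡ next^ pb j x
  next^-old zero d = refl
  next^-old (suc j) d rewrite next^-old j d = next-old (next^-inDom pb j d)

  iter-old : ∀ j {x} → inDom σ x ≡ true → iter σ̃ j x ≡ iter σ j x
  iter-old j d rewrite iter≡next^ p̃b j (inDom-extends d) | iter≡next^ pb j d | next^-old j d = refl

  next-new : ∀ {x} → inDom σ x ≡ false → inDom σ̃ x ≡ true → next p̃b x ≡ x
  next-new {x} d₀ d₁ with inDom⇒just {σ = σ̃} d₁
  ... | w , ew = next-unique p̃b (new-blocks x w d₀ ew) (trans ew (cong just (sym (partner-involutive w))))

  next^-new : ∀ j {x} → inDom σ x ≡ false → inDom σ̃ x ≡ true → next^ p̃b j x ≡ x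
  next^-new zero d₀ d₁ = refl
  next^-new (suc j) d₀ d₁ rewrite next^-new j d₀ d₁ = next-new d₀ d₁

  orbSize-old : ∀ {x} → inDom σ x ≡ true → orbSize σ̃ x ≡ orbSize σ x
  orbSize-old {x} d rewrite orbSize≡search σ̃ x | orbSize≡search σ x =
    search-cong 0 (range1 (2 * n)) (λ m → cong (λ z → eqMPt z (just x)) (iter-old m d))

  onCycle-old : ∀ {x} y → inDom σ x ≡ true → onCycle σ̃ x y ≡ onCycle σ x y
  onCycle-old {x} y d = anyᵇ-cong (0 ∷ range1 (2 * n)) λ m →
    cong₂ (λ a b → eqMPt a (just y) ∨ eqMPt b (just y)) (iter-old m d) (iter-old m (inDom-partner pb d))

  isRep-old : ∀ {x} → inDom σ x ≡ true → isRep σ̃ x ≡ isRep σ x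
  isRep-old {x} d rewrite inDom-extends d | d =
    allᵇ-cong (allPts n) (λ y → cong (λ b → not b ∨ (idx x ≤ᵇ idx y)) (onCycle-old y d))

  isRep-absent : ∀ {x} → inDom σ̃ x ≡ false → isRep σ̃ x ≡ false × isRep σ x ≡ false
  isRep-absent {x} d with inDom σ x in e
  ... | true = ⊥-elim (true≢false (trans (sym (inDom-extends e)) d))
  ... | false rewrite d = refl , refl

  onCycle-new : ∀ {x y} → inDom σ x ≡ false → inDom σ̃ x ≡ true → onCycle σ̃ x y ≡ true → y ≡ x ⊎ y ≡ partner x
  onCycle-new {x} d₀ d₁ oc with onCycle⇒reachable p̃b d₁ oc
  ... | j , inj₁ e = inj₁ (trans (sym e) (next^-new j d₀ d₁))
  ... | j , inj₂ e = inj₂ (trans (sym e) (next^-new j (trans (dom-partner pb x) d₀) (inDom-partner p̃b d₁)))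

  isRep-new-false : ∀ {k} → inDom σ (k , false) ≡ false → inDom σ̃ (k , false) ≡ true →
    isRep σ̃ (k , false) ≡ true
  isRep-new-false {k} d₀ d₁ = least⇒isRep p̃b d₁ least
    where
    least : ∀ y → onCycle σ̃ (k , false) y ≡ true → idx (k , false) ≤ idx y
    least y oc with onCycle-new d₀ d₁ oc
    ... | inj₁ refl = ℕP.≤-refl
    ... | inj₂ refl = ℕP.+-monoʳ-≤ (2 * Fin.toℕ k) z≤n

  isRep-new-true : ∀ {k} → inDom σ̃ (k , true) ≡ true → isRep σ̃ (k , true) ≡ false
  isRep-new-true {k} d₁ with isRep σ̃ (k , true) in r
  ... | false = refl
  ... | true with ℕP.+-cancelˡ-≤ (2 * Fin.toℕ k) 1 0
                   (proj₂ (isRep⇒least p̃b r) (k , false) (reachable⇒onCycle p̃b 0 d₁ z≤n (inj₂ refl)))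
  ...   | ()

  orbSize-new : ∀ {x} → inDom σ x ≡ false → inDom σ̃ x ≡ true → orbSize σ̃ x ≡ 1
  orbSize-new {x} d₀ d₁ = orbSize≡minPeriod p̃b d₁
    (record { returns = next^-new 1 d₀ d₁ ; minimal = λ { j 1≤j (s≤s j≤0) → ⊥-elim (ℕP.<⇒≢ 1≤j (sym (ℕP.n≤0⇒n≡0 j≤0))) } })
    (s≤s z≤n) (1≤2*n x)

  blockParts : Raw n → Fin n → List ℕ
  blockParts s k = map (orbSize s) (filterᵇ (isRep s) (block k))

  parts : Raw n → List (Fin n) → List ℕ
  parts s ks = map (orbSize s) (filterᵇ (isRep s) (concatMap block ks))

  parts-∷ : ∀ s k ks → parts s (k ∷ ks) ≡ blockParts s k ++ parts s ks
  parts-∷ s k ks = trans (cong (map (orbSize s)) (ListP.filter-++ (T? ∘ isRep s) (block k) (concatMap block ks)))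
                         (ListP.map-++ (orbSize s) (filterᵇ (isRep s) (block k)) _)

  isNew : Fin n → Bool
  isNew k = inDom σ̃ (k , false) ∧ not (inDom σ (k , false))

  #new : List (Fin n) → ℕ
  #new ks = length (filterᵇ isNew ks)

  data BlockKind (k : Fin n) : Set where
    old    : inDom σ (k , false) ≡ true → BlockKind k
    new    : inDom σ (k , false) ≡ false → inDom σ̃ (k , false) ≡ true → BlockKind k
    absent : inDom σ (k , false) ≡ false → inDom σ̃ (k , false) ≡ false → BlockKind k

  blockKind : ∀ k → BlockKind k
  blockKind k with inDom σ (k , false) in e₁
  ... | true = old e₁
  ... | false with inDom σ̃ (k , false) in e₂
  ...   | true = new e₁ e₂
  ...   | false = absent e₁ e₂

  blockParts-old : ∀ {k} → inDom σ (k , false) ≡ true → blockParts σ̃ k ≡ blockParts σ k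
  blockParts-old {k} d = map-filterᵇ-cong (block k) sameRep sameSize
    where
    sameRep : ∀ x → x ∈ block k → isRep σ̃ x ≡ isRep σ x
    sameRep x (here refl) = isRep-old d
    sameRep x (there (here refl)) = isRep-old (inDom-partner pb d)
    sameSize : ∀ x → x ∈ block k → orbSize σ̃ x ≡ orbSize σ x
    sameSize x (here refl) = orbSize-old d
    sameSize x (there (here refl)) = orbSize-old (inDom-partner pb d)

  blockParts-new : ∀ {k} → inDom σ (k , false) ≡ false → inDom σ̃ (k , false) ≡ true →
    blockParts σ̃ k ≡ 1 ∷ [] × blockParts σ k ≡ []
  blockParts-new {k} d₀ d₁
    rewrite isRep-new-false d₀ d₁ | isRep-new-true (inDom-partner p̃b d₁) | orbSize-new d₀ d₁
          | d₀ | trans (dom-partner pb (k , false)) d₀ = refl , refl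

  blockParts-absent : ∀ {k} → inDom σ̃ (k , false) ≡ false → blockParts σ̃ k ≡ [] × blockParts σ k ≡ []
  blockParts-absent {k} d
    rewrite proj₁ (isRep-absent d) | proj₂ (isRep-absent d)
          | proj₁ (isRep-absent (trans (dom-partner p̃b (k , false)) d))
          | proj₂ (isRep-absent (trans (dom-partner p̃b (k , false)) d)) = refl , refl

  isNew-old : ∀ {k} → inDom σ (k , false) ≡ true → isNew k ≡ false
  isNew-old d rewrite d | inDom-extends d = refl

  isNew-new : ∀ {k} → inDom σ (k , false) ≡ false → inDom σ̃ (k , false) ≡ true → isNew k ≡ true
  isNew-new d₀ d₁ rewrite d₀ | d₁ = refl

  isNew-absent : ∀ {k} → inDom σ̃ (k , false) ≡ false → isNew k ≡ false
  isNew-absent d₁ rewrite d₁ = refl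

  parts-↭ : ∀ ks → parts σ̃ ks ↭ parts σ ks ++ replicate (#new ks) 1
  parts-↭ [] = ↭.refl
  parts-↭ (k ∷ ks) with blockKind k
  ... | old d = begin
    parts σ̃ (k ∷ ks)                                         ≡⟨ parts-∷ σ̃ k ks ⟩
    blockParts σ̃ k ++ parts σ̃ ks                             ≡⟨ cong (_++ parts σ̃ ks) (blockParts-old d) ⟩
    blockParts σ k ++ parts σ̃ ks                             ↭⟨ ++⁺ˡ (blockParts σ k) (parts-↭ ks) ⟩
    blockParts σ k ++ parts σ ks ++ replicate (#new ks) 1    ≡⟨ ListP.++-assoc (blockParts σ k) _ _ ⟨
    (blockParts σ k ++ parts σ ks) ++ replicate (#new ks) 1  ≡⟨ ++-replicate-cong (parts-∷ σ k ks) (cong length (filterᵇ-reject ks (isNew-old d))) ⟨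
    parts σ (k ∷ ks) ++ replicate (#new (k ∷ ks)) 1          ∎
    where open PermutationReasoning
  ... | new d₀ d₁ = begin
    parts σ̃ (k ∷ ks)                                         ≡⟨ parts-∷ σ̃ k ks ⟩
    blockParts σ̃ k ++ parts σ̃ ks                             ≡⟨ cong (_++ parts σ̃ ks) (proj₁ (blockParts-new d₀ d₁)) ⟩
    1 ∷ parts σ̃ ks                                           ↭⟨ ↭.prep 1 (parts-↭ ks) ⟩
    1 ∷ parts σ ks ++ replicate (#new ks) 1                  ↭⟨ shift 1 (parts σ ks) _ ⟨
    parts σ ks ++ replicate (suc (#new ks)) 1                ≡⟨ ++-replicate-cong (trans (parts-∷ σ k ks) (cong (_++ parts σ ks) (proj₂ (blockParts-new d₀ d₁))))
                                                                       (cong length (filterᵇ-accept ks (isNew-new d₀ d₁))) ⟨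
    parts σ (k ∷ ks) ++ replicate (#new (k ∷ ks)) 1          ∎
    where open PermutationReasoning
  ... | absent d₀ d₁ = begin
    parts σ̃ (k ∷ ks)                                         ≡⟨ trans (parts-∷ σ̃ k ks) (cong (_++ parts σ̃ ks) (proj₁ (blockParts-absent d₁))) ⟩
    parts σ̃ ks                                               ↭⟨ parts-↭ ks ⟩
    parts σ ks ++ replicate (#new ks) 1                      ≡⟨ ++-replicate-cong (trans (parts-∷ σ k ks) (cong (_++ parts σ ks) (proj₂ (blockParts-absent d₁))))
                                                                       (cong length (filterᵇ-reject ks (isNew-absent d₁))) ⟨
    parts σ (k ∷ ks) ++ replicate (#new (k ∷ ks)) 1          ∎
    where open PermutationReasoning

  #blocks-extension : ∀ ks → length (filterᵇ (λ k → inDom σ̃ (k , false)) ks)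
                             ≡ length (filterᵇ (λ k → inDom σ (k , false)) ks) + #new ks
  #blocks-extension [] = refl
  #blocks-extension (k ∷ ks) with blockKind k
  ... | old d rewrite d | inDom-extends d = cong suc (#blocks-extension ks)
  ... | new d₀ d₁ rewrite d₀ | d₁ = trans (cong suc (#blocks-extension ks)) (sym (ℕP.+-suc _ (#new ks)))
  ... | absent d₀ d₁ rewrite d₀ | d₁ = #blocks-extension ks

  isTrivExt-extension : isTrivExt σ σ̃ ≡ true
  isTrivExt-extension = ∧-true (allᵇ⁺ (allPts n) (λ x _ → restricts x))
                               (subst (λ l → eqList (ct σ̃) l ≡ true) ct-extension (eqList-refl (ct σ̃)))
    where
    restricts : ∀ x → (not (inDom σ x) ∨ eqMPt (σ̃ x) (σ x)) ≡ true
    restricts x with inDom σ x in d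
    ... | false = refl
    ... | true = eqMPt-≡ (agrees x d)
    #new-blocks : blocksOfDom σ̃ ∸ blocksOfDom σ ≡ #new (allFin n)
    #new-blocks = trans (cong (_∸ blocksOfDom σ) (#blocks-extension (allFin n))) (ℕP.m+n∸m≡n (blocksOfDom σ) _)
    ct-extension : ct σ̃ ≡ sortDesc (ct σ ++ replicate (blocksOfDom σ̃ ∸ blocksOfDom σ) 1)
    ct-extension rewrite #new-blocks =
      trans (sortDesc-cong-↭ (parts-↭ (allFin n))) (sym (sortDesc-sortDesc-++ (parts σ (allFin n)) _))

-- Pointwise equal maps are indistinguishable by the notions of Defs.  This matters because
-- validRaws enumerates particular function terms: a map built by hand only has a pointwise
-- equal copy there.

findᵇ-cong : ∀ {A : Set} {f g : A → Bool} xs → (∀ x → f x ≡ g x) → findᵇ f xs ≡ findᵇ g xs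
findᵇ-cong [] h = refl
findᵇ-cong {f = f} {g} (x ∷ xs) h rewrite h x | findᵇ-cong {f = f} {g} xs h = refl

module Pointwise {n : ℕ} {σ τ : Raw n} (σ≗τ : σ ≗ τ) where

  inDom-≗ : ∀ x → inDom σ x ≡ inDom τ x
  inDom-≗ x = cong is-just (σ≗τ x)

  inIm-≗ : ∀ y → inIm σ y ≡ inIm τ y
  inIm-≗ y = anyᵇ-cong (allPts n) (λ x → cong (λ m → eqMPt m (just y)) (σ≗τ x))

  step-≗ : ∀ x → step σ x ≡ step τ x
  step-≗ x rewrite σ≗τ (partner x) with τ (partner x)
  ... | nothing = refl
  ... | just y = findᵇ-cong (allPts n) (λ x → cong (λ m → eqMPt m (just (partner y))) (σ≗τ x))

  iter-≗ : ∀ j x → iter σ j x ≡ iter τ j x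
  iter-≗ zero x = refl
  iter-≗ (suc j) x rewrite iter-≗ j x with iter τ j x
  ... | nothing = refl
  ... | just y = step-≗ y

  orbSize-≗ : ∀ x → orbSize σ x ≡ orbSize τ x
  orbSize-≗ x rewrite orbSize≡search σ x | orbSize≡search τ x =
    search-cong 0 (range1 (2 * n)) (λ m → cong (λ t → eqMPt t (just x)) (iter-≗ m x))

  onCycle-≗ : ∀ x y → onCycle σ x y ≡ onCycle τ x y
  onCycle-≗ x y = anyᵇ-cong (0 ∷ range1 (2 * n))
    (λ m → cong₂ (λ a b → eqMPt a (just y) ∨ eqMPt b (just y)) (iter-≗ m x) (iter-≗ m (partner x)))

  isRep-≗ : ∀ x → isRep σ x ≡ isRep τ x
  isRep-≗ x = cong₂ _∧_ (inDom-≗ x)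
    (allᵇ-cong (allPts n) (λ y → cong (λ b → not b ∨ (idx x ≤ᵇ idx y)) (onCycle-≗ x y)))

  ct-≗ : ct σ ≡ ct τ
  ct-≗ = cong sortDesc (map-filterᵇ-cong (allPts n) (λ x _ → isRep-≗ x) (λ x _ → orbSize-≗ x))

  blocksOfDom-≗ : blocksOfDom σ ≡ blocksOfDom τ
  blocksOfDom-≗ = cong length (filterᵇ-cong (allFin n) (λ k → inDom-≗ (k , false)))

  IsPBij-≗ : IsPBij σ → IsPBij τ
  IsPBij-≗ pb = record
    { dom-partner = λ x → trans (sym (inDom-≗ (partner x))) (trans (dom-partner x) (inDom-≗ x))
    ; im-partner  = λ y → trans (sym (inIm-≗ (partner y))) (trans (im-partner y) (inIm-≗ y))
    ; injective   = λ ex ey → injective (trans (σ≗τ _) ex) (trans (σ≗τ _) ey) }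
    where open IsPBij pb

  isTrivExt-≗ˡ : ∀ t → isTrivExt σ t ≡ isTrivExt τ t
  isTrivExt-≗ˡ t = cong₂ _∧_
    (allᵇ-cong (allPts n) (λ x → cong₂ (λ a b → not a ∨ eqMPt (t x) b) (inDom-≗ x) (σ≗τ x)))
    (cong₂ (λ a b → eqList (ct t) (sortDesc (a ++ replicate (blocksOfDom t ∸ b) 1))) ct-≗ blocksOfDom-≗)

  isTrivExt-≗ʳ : ∀ s → isTrivExt s σ ≡ isTrivExt s τ
  isTrivExt-≗ʳ s = cong₂ _∧_
    (allᵇ-cong (allPts n) (λ x → cong (λ a → not (inDom s x) ∨ eqMPt a (s x)) (σ≗τ x)))
    (cong₂ (λ a b → eqList a (sortDesc (ct s ++ replicate (b ∸ blocksOfDom s) 1))) ct-≗ blocksOfDom-≗)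

  PExt-≗ : PExt σ ≡ PExt τ
  PExt-≗ = filterᵇ-cong (validRaws n) isTrivExt-≗ˡ

open Pointwise using (inDom-≗; inIm-≗; ct-≗; IsPBij-≗; isTrivExt-≗ʳ; PExt-≗)

Eset-≗ : ∀ {n} {σ₁ σ₁' σ₂ σ₂' : Raw n} → σ₁ ≗ σ₁' → σ₂ ≗ σ₂' → Eset σ₁ σ₂ ≡ Eset σ₁' σ₂'
Eset-≗ {n} {σ₁' = σ₁'} {σ₂' = σ₂'} h₁ h₂ rewrite PExt-≗ h₁ | PExt-≗ h₂ =
  filterᵇ-cong (cartesianProduct (PExt σ₁') (PExt σ₂')) λ p → allᵇ-cong (allPts n) λ x →
    cong (λ c → eqBool (inDom (proj₁ p) x) c ∧ eqBool (inIm (proj₂ p) x) c)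
         (cong₂ _∨_ (inDom-≗ h₁ x) (inIm-≗ h₂ x))

compose-≗ : ∀ {n} {a a' b b' : Raw n} → a ≗ a' → b ≗ b' → compose a b ≗ compose a' b'
compose-≗ {b' = b'} a≗a' b≗b' x rewrite b≗b' x with b' x
... | nothing = refl
... | just y = a≗a' y

basisProd-≗ : ∀ {n} {σ₁ σ₁' σ₂ σ₂' : Raw n} γ → σ₁ ≗ σ₁' → σ₂ ≗ σ₂' → basisProd σ₁ σ₂ γ ≡ basisProd σ₁' σ₂' γ
basisProd-≗ γ h₁ h₂ rewrite Eset-≗ h₁ h₂ = refl

∈-allMPts : ∀ {n} (m : Maybe (Pt n)) → m ∈ allMPts n
∈-allMPts nothing = here refl
∈-allMPts (just y) = there (∈-map⁺ just (∈-allPts y))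

funsOn-complete : ∀ {n} (σ : Raw n) (ps : List (Pt n)) →
  Σ (Raw n) (λ f → f ∈ funsOn ps × (∀ x → x ∈ ps → f x ≡ σ x))
funsOn-complete σ [] = (λ _ → nothing) , here refl , λ _ ()
funsOn-complete {n} σ (p ∷ ps) with funsOn-complete σ ps
... | f , f∈ , f≗σ = update (σ p) f , f'∈ , agrees
  where
  update : Maybe (Pt n) → Raw n → Raw n
  update v f x = if eqPt x p then v else f x
  f'∈ : update (σ p) f ∈ funsOn (p ∷ ps)
  f'∈ = ∈-concatMap⁺ (λ v → map (update v) (funsOn ps))
          (lose (∈-allMPts (σ p)) (∈-map⁺ (update (σ p)) f∈))
  agrees : ∀ x → x ∈ p ∷ ps → update (σ p) f x ≡ σ x
  agrees x x∈ with eqPt x p in e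
  ... | true = cong σ (sym (eqPt⇒≡ e))
  ... | false with x∈
  ...   | here refl = ⊥-elim (true≢false (trans (sym (eqPt-refl x)) e))
  ...   | there x∈ps = f≗σ x x∈ps

validRaws-complete : ∀ {n} (σ : Raw n) → IsPBij σ → Σ (Raw n) (λ c → c ∈ validRaws n × c ≗ σ)
validRaws-complete {n} σ pb with funsOn-complete σ (allPts n)
... | f , f∈ , f≗σ = f , ∈-filterᵇ⁺ f∈ (T⇒≡true (IsPBij⇒valid (IsPBij-≗ (sym ∘ f≗σ') pb))) , f≗σ'
  where
  f≗σ' : f ≗ σ
  f≗σ' x = f≗σ x (∈-allPts x)

toQ : ∀ {n} {σ : Raw n} → σ ∈ validRaws n → Q n
toQ {n} {σ} σ∈ = σ , ≡true⇒T (proj₂ (∈-filterᵇ⁻ {p = valid} {xs = funsOn (allPts n)} σ∈))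

module Transposition {n : ℕ} (a b : Pt n) (a≢b : a ≢ b) where

  swap : Pt n → Pt n
  swap y with y ≟ᴾ a | y ≟ᴾ b
  ... | yes _ | _     = b
  ... | no _  | yes _ = a
  ... | no _  | no _  = y

  data SwapView (y s : Pt n) : Set where
    at-a  : y ≡ a → s ≡ b → SwapView y s
    at-b  : y ≡ b → s ≡ a → SwapView y s
    fixed : y ≢ a → y ≢ b → s ≡ y → SwapView y s

  swapView : ∀ y → SwapView y (swap y)
  swapView y with y ≟ᴾ a | y ≟ᴾ b
  ... | yes y≡a | _       = at-a y≡a refl
  ... | no y≢a  | yes y≡b = at-b y≡b refl
  ... | no y≢a  | no y≢b  = fixed y≢a y≢b refl

  swap-a : swap a ≡ b
  swap-a with swapView a
  ... | at-a _ s = s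
  ... | at-b a≡b _ = ⊥-elim (a≢b a≡b)
  ... | fixed a≢a _ _ = ⊥-elim (a≢a refl)

  swap-b : swap b ≡ a
  swap-b with swapView b
  ... | at-a b≡a _ = ⊥-elim (a≢b (sym b≡a))
  ... | at-b _ s = s
  ... | fixed _ b≢b _ = ⊥-elim (b≢b refl)

  swap-fixed : ∀ {y} → y ≢ a → y ≢ b → swap y ≡ y
  swap-fixed {y} y≢a y≢b with swapView y
  ... | at-a y≡a _ = ⊥-elim (y≢a y≡a)
  ... | at-b y≡b _ = ⊥-elim (y≢b y≡b)
  ... | fixed _ _ s = s

  swap-involutive : ∀ y → swap (swap y) ≡ y
  swap-involutive y with swapView y
  ... | at-a refl s rewrite s = swap-b
  ... | at-b refl s rewrite s = swap-a
  ... | fixed y≢a y≢b s rewrite s = swap-fixed y≢a y≢b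

  swap-injective : ∀ {x y} → swap x ≡ swap y → x ≡ y
  swap-injective {x} {y} e = trans (sym (swap-involutive x)) (trans (cong swap e) (swap-involutive y))

0≤*0≤ : ∀ {p q} → 0ℚ ℚ.≤ p → 0ℚ ℚ.≤ q → 0ℚ ℚ.≤ p ℚ.* q
0≤*0≤ {p} {q} 0≤p 0≤q =
  ℚP.nonNegative⁻¹ (p ℚ.* q) {{ℚP.nonNeg*nonNeg⇒nonNeg p {{ℚ.nonNegative 0≤p}} q {{ℚ.nonNegative 0≤q}}}}

0<*0< : ∀ {p q} → 0ℚ ℚ.< p → 0ℚ ℚ.< q → 0ℚ ℚ.< p ℚ.* q
0<*0< {p} {q} 0<p 0<q = ℚP.positive⁻¹ (p ℚ.* q) {{ℚP.pos*pos⇒pos p {{ℚ.positive 0<p}} q {{ℚ.positive 0<q}}}}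

0≤+0≤ : ∀ {p q} → 0ℚ ℚ.≤ p → 0ℚ ℚ.≤ q → 0ℚ ℚ.≤ p ℚ.+ q
0≤+0≤ {p} {q} 0≤p 0≤q =
  ℚP.nonNegative⁻¹ (p ℚ.+ q) {{ℚP.nonNeg+nonNeg⇒nonNeg p {{ℚ.nonNegative 0≤p}} q {{ℚ.nonNegative 0≤q}}}}

0<+0≤ : ∀ {p q} → 0ℚ ℚ.< p → 0ℚ ℚ.≤ q → 0ℚ ℚ.< p ℚ.+ q
0<+0≤ {p} {q} 0<p 0≤q = ℚP.positive⁻¹ (p ℚ.+ q) {{ℚP.pos+nonNeg⇒pos p {{ℚ.positive 0<p}} q {{ℚ.nonNegative 0≤q}}}}

0≤+0< : ∀ {p q} → 0ℚ ℚ.≤ p → 0ℚ ℚ.< q → 0ℚ ℚ.< p ℚ.+ q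
0≤+0< {p} {q} 0≤p 0<q = ℚP.positive⁻¹ (p ℚ.+ q) {{ℚP.nonNeg+pos⇒pos p {{ℚ.nonNegative 0≤p}} q {{ℚ.positive 0<q}}}}

sumℚ-nonNeg : ∀ {A : Set} (f : A → ℚ) xs → (∀ x → x ∈ xs → 0ℚ ℚ.≤ f x) → 0ℚ ℚ.≤ sumℚ (map f xs)
sumℚ-nonNeg f [] _ = ℚP.≤-refl
sumℚ-nonNeg f (x ∷ xs) 0≤f = 0≤+0≤ (0≤f x (here refl)) (sumℚ-nonNeg f xs (λ y m → 0≤f y (there m)))

sumℚ-pos : ∀ {A : Set} (f : A → ℚ) xs {x} → x ∈ xs → 0ℚ ℚ.< f x → (∀ y → y ∈ xs → 0ℚ ℚ.≤ f y) →
  0ℚ ℚ.< sumℚ (map f xs)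
sumℚ-pos f (y ∷ xs) (here refl) 0<fx 0≤f = 0<+0≤ 0<fx (sumℚ-nonNeg f xs (λ z m → 0≤f z (there m)))
sumℚ-pos f (y ∷ xs) (there x∈) 0<fx 0≤f = 0≤+0< (0≤f y (here refl)) (sumℚ-pos f xs x∈ 0<fx (λ z m → 0≤f z (there m)))

divℚ-nonNeg : ∀ a b → 0ℚ ℚ.≤ divℚ a b
divℚ-nonNeg a zero = ℚP.≤-refl
divℚ-nonNeg a (suc m) = ℚP.nonNegative⁻¹ _ {{ℚP.normalize-nonNeg a (suc m)}}

divℚ-pos : ∀ a b → 1 ≤ a → a ≤ b → 0ℚ ℚ.< divℚ a b
divℚ-pos (suc a) (suc m) _ _ = ℚP.positive⁻¹ _ {{ℚP.normalize-pos (suc a) (suc m)}}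

0<1 : 0ℚ ℚ.< 1ℚ
0<1 = ℚP.positive⁻¹ 1ℚ

basis-nonNeg : ∀ {n} (t : Q n) γ → 0ℚ ℚ.≤ basis t γ
basis-nonNeg t γ with eqRaw (proj₁ t) γ
... | true = ℚP.<⇒≤ 0<1
... | false = ℚP.≤-refl

basis-self : ∀ {n} (t : Q n) → basis t (proj₁ t) ≡ 1ℚ
basis-self t rewrite eqRaw-refl (proj₁ t) = refl

basisProd-nonNeg : ∀ {n} (a b γ : Raw n) → 0ℚ ℚ.≤ basisProd a b γ
basisProd-nonNeg a b γ =
  divℚ-nonNeg (length (filterᵇ (λ p → eqRaw (compose (proj₁ p) (proj₂ p)) γ) (Eset a b))) (length (Eset a b))

basisProd-pos : ∀ {n} (a b γ : Raw n) {p} → p ∈ Eset a b → eqRaw (compose (proj₁ p) (proj₂ p)) γ ≡ true →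
  0ℚ ℚ.< basisProd a b γ
basisProd-pos a b γ p∈E composes =
  divℚ-pos _ _ (nonEmpty (∈-filterᵇ⁺ p∈E composes)) (length-filterᵇ (Eset a b))
  where
  nonEmpty : ∀ {A : Set} {x : A} {xs} → x ∈ xs → 1 ≤ length xs
  nonEmpty (here _) = s≤s z≤n
  nonEmpty (there _) = s≤s z≤n

module _ {n : ℕ} {f g : Elt n} (0≤f : ∀ a → 0ℚ ℚ.≤ f a) (0≤g : ∀ b → 0ℚ ℚ.≤ g b) where

  ⋆-nonNeg : ∀ γ → 0ℚ ℚ.≤ (f ⋆ g) γ
  ⋆-nonNeg γ = sumℚ-nonNeg _ (validRaws n) λ a _ → sumℚ-nonNeg _ (validRaws n) λ b _ →
    0≤*0≤ (0≤*0≤ (0≤f a) (0≤g b)) (basisProd-nonNeg a b γ)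

  ⋆-pos : ∀ {a b γ} → a ∈ validRaws n → b ∈ validRaws n →
    0ℚ ℚ.< f a → 0ℚ ℚ.< g b → 0ℚ ℚ.< basisProd a b γ → 0ℚ ℚ.< (f ⋆ g) γ
  ⋆-pos {a} {b} {γ} a∈ b∈ 0<fa 0<gb 0<ab =
    sumℚ-pos _ (validRaws n) a∈
      (sumℚ-pos _ (validRaws n) b∈ (0<*0< (0<*0< 0<fa 0<gb) 0<ab) λ b' _ → term-nonNeg a b')
      (λ a' _ → sumℚ-nonNeg _ (validRaws n) λ b' _ → term-nonNeg a' b')
    where
    term-nonNeg : ∀ a' b' → 0ℚ ℚ.≤ f a' ℚ.* g b' ℚ.* basisProd a' b' γ
    term-nonNeg a' b' = 0≤*0≤ (0≤*0≤ (0≤f a') (0≤g b')) (basisProd-nonNeg a' b' γ)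

prodVec-nonNeg : ∀ {n r} (τ : Vec (Q n) r) γ → 0ℚ ℚ.≤ prodVec τ γ
prodVec-nonNeg [] γ = ℚP.≤-refl
prodVec-nonNeg (t ∷ []) γ = basis-nonNeg t γ
prodVec-nonNeg (t ∷ u ∷ ts) = ⋆-nonNeg (basis-nonNeg t) (prodVec-nonNeg (u ∷ ts))

TranspositionWitness : ∀ {n} → ℕ → Raw n → Set
TranspositionWitness {n} r γ =
  Σ (Vec (Q n) r) (λ τs → ((i : Fin r) → cosetType (lookup τs i) ≡ 2 ∷ []) × 0ℚ ℚ.< prodVec τs γ)

is-just-map : ∀ {A B : Set} (f : A → B) (m : Maybe A) → is-just (mapᴹ f m) ≡ is-just m
is-just-map f (just x) = refl
is-just-map f nothing = refl

parity : ∀ a → Σ ℕ (λ c → a ≡ c + c ⊎ a ≡ suc (c + c))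
parity zero = 0 , inj₁ refl
parity (suc a) with parity a
... | c , inj₁ e = c , inj₂ (cong suc e)
... | c , inj₂ e = suc c , inj₁ (trans (cong suc e) (cong suc (sym (ℕP.+-suc c c))))

module Split {n : ℕ} {C : Raw n} (pC : IsPBij C) {z : Pt n} {k : ℕ} (cycle : SingleCycle pC z (suc (suc k)))
             {u v : Pt n} (Cz : C z ≡ just u) (Cz̄ : C (partner z) ≡ just v) where

  open IsPBij pC
  open SingleCycle cycle

  len : ℕ
  len = suc (suc (suc k))

  orb orb̄ : ℕ → Pt n
  orb i = next^ pC i z
  orb̄ i = next^ pC i (partner z)

  z̄-inDom : inDom C (partner z) ≡ true
  z̄-inDom = inDom-partner inDom-base

  z̄-period : MinPeriod pC (partner z) len
  z̄-period = minPeriod-partner pC inDom-base period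

  orb-inDom : ∀ i → inDom C (orb i) ≡ true
  orb-inDom i = next^-inDom pC i inDom-base

  orb̄-inDom : ∀ i → inDom C (orb̄ i) ≡ true
  orb̄-inDom i = next^-inDom pC i z̄-inDom

  orb-injective : ∀ {i j} → i < len → j < len → orb i ≡ orb j → i ≡ j
  orb-injective = minPeriod-injective pC inDom-base period

  orb̄-injective : ∀ {i j} → i < len → j < len → orb̄ i ≡ orb̄ j → i ≡ j
  orb̄-injective = minPeriod-injective pC z̄-inDom z̄-period

  -- If g^(2c) z = partner z then g^c z = partner (g^c z); if g^(2c+1) z = partner z then
  -- g (g^c z) = partner (g^c z).  Both are impossible.
  orb≢partner-z : ∀ a → orb a ≢ partner z
  orb≢partner-z a eq with parity a
  ... | c , inj₁ refl = partner-≢ (orb c)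
        (next^-injective pC c (inDom-partner (orb-inDom c)) (orb-inDom c)
          (trans (next^-partner-next^ pC c inDom-base) (trans (sym eq) (next^-+ pC c c z))))
  ... | c , inj₂ refl = next≢partner pC (orb-inDom c)
        (sym (next^-injective pC c (inDom-partner (orb-inDom c)) (next-inDom pC (orb-inDom c))
          (trans (next^-partner-next^ pC c inDom-base)
            (trans (sym eq) (trans (cong (λ t → next^ pC t z) (sym (ℕP.+-suc c c))) (next^-+ pC c (suc c) z))))))

  orb≢orb̄ : ∀ i j → orb i ≢ orb̄ j
  orb≢orb̄ i j eq = orb≢partner-z (j * suc (suc k) + i) (begin
    next^ pC (j * suc (suc k) + i) z                   ≡⟨ next^-+ pC (j * suc (suc k)) i z ⟩
    next^ pC (j * suc (suc k)) (orb i)                 ≡⟨ cong (next^ pC (j * suc (suc k))) eq ⟩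
    next^ pC (j * suc (suc k)) (next^ pC j (partner z)) ≡⟨ next^-+ pC (j * suc (suc k)) j (partner z) ⟨
    next^ pC (j * suc (suc k) + j) (partner z)         ≡⟨ cong (λ t → next^ pC t (partner z)) j*[2+k]+j≡j*len ⟩
    next^ pC (j * len) (partner z)                     ≡⟨ next^-multiple pC z̄-period j ⟩
    partner z                                          ∎)
    where
    open ≡-Reasoning
    j*[2+k]+j≡j*len : j * suc (suc k) + j ≡ j * len
    j*[2+k]+j≡j*len = trans (ℕP.+-comm (j * suc (suc k)) j) (sym (ℕP.*-suc j (suc (suc k))))

  partner-orb̄1 : partner (orb̄ 1) ≡ orb (suc (suc k))
  partner-orb̄1 = next-injective pC (inDom-partner (orb̄-inDom 1)) (orb-inDom (suc (suc k)))
    (trans (next-partner-next pC z̄-inDom) (trans (partner-involutive z) (sym (MinPeriod.returns period))))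

  partner-orb1 : partner (orb 1) ≡ orb̄ (suc (suc k))
  partner-orb1 = next-injective pC (inDom-partner (orb-inDom 1)) (orb̄-inDom (suc (suc k)))
    (trans (next-partner-next pC inDom-base) (sym (MinPeriod.returns z̄-period)))

  orb1≢z : orb 1 ≢ z
  orb1≢z = MinPeriod.minimal period 1 (s≤s z≤n) (s≤s (s≤s z≤n))

  C-orb̄1 : C (orb̄ 1) ≡ just (partner u)
  C-orb̄1 = next-image pC z̄-inDom (trans (cong C (partner-involutive z)) Cz)

  C-orb1 : C (orb 1) ≡ just (partner v)
  C-orb1 = next-image pC inDom-base Cz̄

  u≢v : u ≢ v
  u≢v eq = partner-≢ z (sym (injective Cz (trans Cz̄ (cong just (sym eq)))))

  block-u≢block-v : proj₁ u ≢ proj₁ v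
  block-u≢block-v eq with sameBlock eq
  ... | inj₁ u≡v = u≢v u≡v
  ... | inj₂ u≡v̄ = orb1≢z (injective C-orb1 (trans Cz (cong just u≡v̄)))

  ū≢v : partner u ≢ v
  ū≢v eq = block-u≢block-v (cong proj₁ eq)

  open Transposition v (partner u) (ū≢v ∘ sym)

  v∈Im : inIm C v ≡ true
  v∈Im = inIm-just {σ = C} Cz̄

  ū∈Im : inIm C (partner u) ≡ true
  ū∈Im = inIm-just {σ = C} C-orb̄1

  inIm-swap : ∀ y → inIm C (swap y) ≡ inIm C y
  inIm-swap y with swapView y
  ... | at-a refl s rewrite s = trans ū∈Im (sym v∈Im)
  ... | at-b refl s rewrite s = trans v∈Im (sym ū∈Im)
  ... | fixed _ _ s rewrite s = refl

  C̃ : Raw n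
  C̃ y = mapᴹ swap (C y)

  C̃-just : ∀ {x a} → C x ≡ just a → C̃ x ≡ just (swap a)
  C̃-just e rewrite e = refl

  C̃-just⁻ : ∀ {x w} → C̃ x ≡ just w → Σ (Pt n) (λ a → C x ≡ just a × swap a ≡ w)
  C̃-just⁻ {x} e with C x
  ... | just a with e
  ...   | refl = a , refl , refl

  inDom-C̃ : ∀ x → inDom C̃ x ≡ inDom C x
  inDom-C̃ x = is-just-map swap (C x)

  inIm-C̃ : ∀ y → inIm C̃ y ≡ inIm C y
  inIm-C̃ y = Bool-ext to from
    where
    to : inIm C̃ y ≡ true → inIm C y ≡ true
    to i with inIm⇒preimage {σ = C̃} i
    ... | x , ex with C̃-just⁻ ex
    ...   | a , ca , refl = trans (inIm-swap a) (inIm-just {σ = C} ca)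
    from : inIm C y ≡ true → inIm C̃ y ≡ true
    from i with inIm⇒preimage {σ = C} (trans (inIm-swap y) i)
    ... | x , ex = inIm-just {σ = C̃} (trans (C̃-just ex) (cong just (swap-involutive y)))

  C̃-pbij : IsPBij C̃
  C̃-pbij = record
    { dom-partner = λ x → trans (inDom-C̃ (partner x)) (trans (dom-partner x) (sym (inDom-C̃ x)))
    ; im-partner  = λ y → trans (inIm-C̃ (partner y)) (trans (im-partner y) (sym (inIm-C̃ y)))
    ; injective   = injective-C̃ }
    where
    injective-C̃ : ∀ {x y w} → C̃ x ≡ just w → C̃ y ≡ just w → x ≡ y
    injective-C̃ ex ey with C̃-just⁻ ex | C̃-just⁻ ey
    ... | a , ca , sa | b , cb , sb = injective ca (trans cb (cong just (swap-injective (trans sb (sym sa)))))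

  C' : Raw n
  C' y = if does (proj₁ y Fin.≟ proj₁ z) then nothing else C̃ y

  C'-elsewhere : ∀ {y} → proj₁ y ≢ proj₁ z → C' y ≡ C̃ y
  C'-elsewhere {y} ne with proj₁ y Fin.≟ proj₁ z
  ... | yes e = ⊥-elim (ne e)
  ... | no _ = refl

  C'-just⁻ : ∀ {x w} → C' x ≡ just w → C̃ x ≡ just w × proj₁ x ≢ proj₁ z
  C'-just⁻ {x} e with proj₁ x Fin.≟ proj₁ z
  ... | no ne = e , ne

  inIm-C'⇔ : ∀ y → (inIm C' y ≡ true → inIm C y ≡ true × proj₁ y ≢ proj₁ u)
                 × (inIm C y ≡ true × proj₁ y ≢ proj₁ u → inIm C' y ≡ true)
  inIm-C'⇔ y = to , from
    where
    to : inIm C' y ≡ true → inIm C y ≡ true × proj₁ y ≢ proj₁ u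
    to i with inIm⇒preimage {σ = C'} i
    ... | x , ex with C'-just⁻ {x} ex
    ...   | C̃x , x∉z with C̃-just⁻ C̃x
    ...     | a , Cx , refl = trans (inIm-swap a) (inIm-just {σ = C} Cx) , not-u
      where
      not-u : proj₁ (swap a) ≢ proj₁ u
      not-u eq with sameBlock eq | swapView a
      ... | _        | at-a a≡v _ = x∉z (cong proj₁ (injective Cx (trans Cz̄ (cong just (sym a≡v)))))
      ... | inj₁ s≡u | at-b _ s   = u≢v (trans (sym s≡u) s)
      ... | inj₂ s≡ū | at-b _ s   = ū≢v (trans (sym s≡ū) s)
      ... | inj₁ s≡u | fixed _ _ s = x∉z (cong proj₁ (injective Cx (trans Cz (cong just (sym (trans (sym s) s≡u))))))
      ... | inj₂ s≡ū | fixed _ a≢ū s = a≢ū (trans (sym s) s≡ū)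
    from : inIm C y ≡ true × proj₁ y ≢ proj₁ u → inIm C' y ≡ true
    from (i , y∉u) with inIm⇒preimage {σ = C} (trans (inIm-swap y) i)
    ... | x , ex = inIm-just {σ = C'} (trans (C'-elsewhere {x} x∉z) (trans (C̃-just ex) (cong just (swap-involutive y))))
      where
      x∉z : proj₁ x ≢ proj₁ z
      x∉z eb with sameBlock {x = x} {y = z} eb
      ... | inj₁ refl = y∉u (cong proj₁ (trans (sym (swap-involutive y))
                          (trans (cong swap (MaybeP.just-injective (trans (sym ex) Cz))) (swap-fixed u≢v (partner-≢ u ∘ sym)))))
      ... | inj₂ refl = y∉u (cong proj₁ (trans (sym (swap-involutive y))
                          (trans (cong swap (MaybeP.just-injective (trans (sym ex) Cz̄))) swap-a)))

  C'-pbij : IsPBij C'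
  C'-pbij = record
    { dom-partner = dom-partner'
    ; im-partner  = partnerClosed⇒inIm-partner {σ = C'} (λ y → inIm C y ≡ true × proj₁ y ≢ proj₁ u)
                      (proj₁ ∘ inIm-C'⇔) (proj₂ ∘ inIm-C'⇔) (λ y (i , y∉u) → trans (im-partner y) i , y∉u)
    ; injective   = λ {x} {y} ex ey → IsPBij.injective C̃-pbij (proj₁ (C'-just⁻ {x} ex)) (proj₁ (C'-just⁻ {y} ey)) }
    where
    dom-partner' : ∀ x → inDom C' (partner x) ≡ inDom C' x
    dom-partner' x with proj₁ x Fin.≟ proj₁ z
    ... | yes _ = refl
    ... | no _  = IsPBij.dom-partner C̃-pbij x

  τ̃ : Raw n
  τ̃ y = if inIm C y then just (swap y) else nothing

  τ̃-just : ∀ {y} → inIm C y ≡ true → τ̃ y ≡ just (swap y)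
  τ̃-just e rewrite e = refl

  τ̃-just⁻ : ∀ {x w} → τ̃ x ≡ just w → inIm C x ≡ true × swap x ≡ w
  τ̃-just⁻ {x} e with inIm C x
  ... | true with e
  ...   | refl = refl , refl

  inDom-τ̃ : ∀ x → inDom τ̃ x ≡ inIm C x
  inDom-τ̃ x with inIm C x
  ... | true = refl
  ... | false = refl

  inIm-τ̃ : ∀ y → inIm τ̃ y ≡ inIm C y
  inIm-τ̃ y = Bool-ext to from
    where
    to : inIm τ̃ y ≡ true → inIm C y ≡ true
    to i with inIm⇒preimage {σ = τ̃} i
    ... | x , ex with τ̃-just⁻ {x} ex
    ...   | ix , refl = trans (inIm-swap x) ix
    from : inIm C y ≡ true → inIm τ̃ y ≡ true
    from i = inIm-just {σ = τ̃} (trans (τ̃-just (trans (inIm-swap y) i)) (cong just (swap-involutive y)))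

  τ̃-pbij : IsPBij τ̃
  τ̃-pbij = record
    { dom-partner = λ x → trans (inDom-τ̃ (partner x)) (trans (im-partner x) (sym (inDom-τ̃ x)))
    ; im-partner  = λ y → trans (inIm-τ̃ (partner y)) (trans (im-partner y) (sym (inIm-τ̃ y)))
    ; injective   = λ {x} {y} ex ey → swap-injective (trans (proj₂ (τ̃-just⁻ {x} ex)) (sym (proj₂ (τ̃-just⁻ {y} ey)))) }

  InBlocks-uv : Pt n → Set
  InBlocks-uv y = proj₁ y ≡ proj₁ u ⊎ proj₁ y ≡ proj₁ v

  inBlocks-uv? : ∀ y → Dec (InBlocks-uv y)
  inBlocks-uv? y = (proj₁ y Fin.≟ proj₁ u) ⊎-dec (proj₁ y Fin.≟ proj₁ v)

  swapIf : ∀ {P : Set} → Dec P → Pt n → Maybe (Pt n)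
  swapIf d y = if does d then just (swap y) else nothing

  τ : Raw n
  τ y = swapIf (inBlocks-uv? y) y

  τ-just : ∀ {y} → InBlocks-uv y → τ y ≡ just (swap y)
  τ-just {y} = go (inBlocks-uv? y)
    where
    go : (d : Dec (InBlocks-uv y)) → InBlocks-uv y → swapIf d y ≡ just (swap y)
    go (yes _) _ = refl
    go (no ¬b) b = ⊥-elim (¬b b)

  τ-nothing : ∀ {y} → ¬ InBlocks-uv y → τ y ≡ nothing
  τ-nothing {y} = go (inBlocks-uv? y)
    where
    go : (d : Dec (InBlocks-uv y)) → ¬ InBlocks-uv y → swapIf d y ≡ nothing
    go (yes b) ¬b = ⊥-elim (¬b b)
    go (no _) _ = refl

  τ-just⁻ : ∀ {x w} → τ x ≡ just w → InBlocks-uv x × swap x ≡ w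
  τ-just⁻ {x} = go (inBlocks-uv? x)
    where
    go : ∀ {w} (d : Dec (InBlocks-uv x)) → swapIf d x ≡ just w → InBlocks-uv x × swap x ≡ w
    go (yes b) refl = b , refl

  inBlocks-uv-swap : ∀ {y} → InBlocks-uv y → InBlocks-uv (swap y)
  inBlocks-uv-swap {y} b with swapView y
  ... | at-a _ s rewrite s = inj₁ refl
  ... | at-b _ s rewrite s = inj₂ refl
  ... | fixed _ _ s rewrite s = b

  inDom-τ⇒inBlocks-uv : ∀ {x} → inDom τ x ≡ true → InBlocks-uv x
  inDom-τ⇒inBlocks-uv {x} d with inDom⇒just {σ = τ} d
  ... | w , e = proj₁ (τ-just⁻ {x} e)

  τ-pbij : IsPBij τ
  τ-pbij = record
    { dom-partner = λ x → Bool-ext (λ d → inDom-just {σ = τ} {x = x} (τ-just {x} (inDom-τ⇒inBlocks-uv {partner x} d)))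
                                   (λ d → inDom-just {σ = τ} {x = partner x} (τ-just {partner x} (inDom-τ⇒inBlocks-uv {x} d)))
    ; im-partner  = partnerClosed⇒inIm-partner {σ = τ} InBlocks-uv
        (λ y i → let (x , ex) = inIm⇒preimage {σ = τ} i in subst InBlocks-uv (proj₂ (τ-just⁻ {x} ex)) (inBlocks-uv-swap {x} (proj₁ (τ-just⁻ {x} ex))))
        (λ y b → inIm-just {σ = τ} {x = swap y} (trans (τ-just {swap y} (inBlocks-uv-swap {y} b)) (cong just (swap-involutive y))))
        (λ y b → b)
    ; injective   = λ {x} {y} ex ey → swap-injective (trans (proj₂ (τ-just⁻ {x} ex)) (sym (proj₂ (τ-just⁻ {y} ey)))) }

  swap-u : swap u ≡ u
  swap-u = swap-fixed u≢v (partner-≢ u ∘ sym)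

  swap-v̄ : swap (partner v) ≡ partner v
  swap-v̄ = swap-fixed (partner-≢ v) (u≢v ∘ sym ∘ partner-injective)

  τ-u : τ u ≡ just u
  τ-u = trans (τ-just {u} (inj₁ refl)) (cong just swap-u)

  τ-ū : τ (partner u) ≡ just v
  τ-ū = trans (τ-just {partner u} (inj₁ refl)) (cong just swap-b)

  τ-v : τ v ≡ just (partner u)
  τ-v = trans (τ-just {v} (inj₂ refl)) (cong just swap-a)

  τ-v̄ : τ (partner v) ≡ just (partner v)
  τ-v̄ = trans (τ-just {partner v} (inj₂ refl)) (cong just swap-v̄)

  τ-next-u : next τ-pbij u ≡ partner v
  τ-next-u = next-unique τ-pbij τ-ū τ-v̄

  τ-next-v̄ : next τ-pbij (partner v) ≡ u
  τ-next-v̄ = next-unique τ-pbij (trans (cong τ (partner-involutive v)) τ-v) (trans τ-u (cong just (sym (partner-involutive u))))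

  τ-next-ū : next τ-pbij (partner u) ≡ v
  τ-next-ū = next-unique τ-pbij (trans (cong τ (partner-involutive u)) τ-u) τ-v

  2≤2*n : 2 ≤ 2 * n
  2≤2*n = ℕP.*-monoʳ-≤ 2 (1≤n z)
    where
    1≤n : ∀ {n} → Pt n → 1 ≤ n
    1≤n {suc n} _ = s≤s z≤n

  τ-singleCycle : SingleCycle τ-pbij u 1
  τ-singleCycle = record
    { inDom-base = inDom-just {σ = τ} τ-u
    ; length≤ = 2≤2*n
    ; period = record { returns = trans (cong (next τ-pbij) τ-next-u) τ-next-v̄ ; minimal = τ-minimal }
    ; covers = τ-covers }
    where
    τ-minimal : ∀ j → 1 ≤ j → j < 2 → next^ τ-pbij j u ≢ u
    τ-minimal 1 _ _ e = block-u≢block-v (sym (cong proj₁ (trans (sym τ-next-u) e)))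
    τ-minimal (suc (suc j)) _ (s≤s (s≤s ()))
    τ-covers : ∀ y → inDom τ y ≡ true → Σ ℕ (λ j → y ≡ next^ τ-pbij j u ⊎ y ≡ next^ τ-pbij j (partner u))
    τ-covers y d with inDom-τ⇒inBlocks-uv {y} d
    ... | inj₁ y∈u with sameBlock {x = y} {y = u} y∈u
    ...   | inj₁ y≡u = 0 , inj₁ y≡u
    ...   | inj₂ y≡ū = 0 , inj₂ y≡ū
    τ-covers y d | inj₂ y∈v with sameBlock {x = y} {y = v} y∈v
    ...   | inj₁ y≡v = 1 , inj₂ (trans y≡v (sym τ-next-ū))
    ...   | inj₂ y≡v̄ = 1 , inj₁ (trans y≡v̄ (sym τ-next-u))

  ct-τ : ct τ ≡ 2 ∷ []
  ct-τ = singleCycle⇒ct τ-pbij τ-singleCycle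

  C'≡C : ∀ y → y ≢ z → y ≢ partner z → y ≢ orb̄ 1 → C' y ≡ C y
  C'≡C y y≢z y≢z̄ y≢orb̄1 = trans (C'-elsewhere {y} y∉z) (swap-outside (C y) refl)
    where
    y∉z : proj₁ y ≢ proj₁ z
    y∉z eb with sameBlock {x = y} {y = z} eb
    ... | inj₁ e = y≢z e
    ... | inj₂ e = y≢z̄ e
    swap-outside : ∀ m → C y ≡ m → mapᴹ swap m ≡ m
    swap-outside nothing _ = refl
    swap-outside (just w) Cy = cong just (swap-fixed (λ w≡v → y≢z̄ (injective Cy (trans Cz̄ (cong just (sym w≡v)))))
                                                     (λ w≡ū → y≢orb̄1 (injective Cy (trans C-orb̄1 (cong just (sym w≡ū))))))

  next'≡next : ∀ x → inDom C x ≡ true →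
    partner x ≢ z → partner x ≢ partner z → partner x ≢ orb̄ 1 →
    next pC x ≢ z → next pC x ≢ partner z → next pC x ≢ orb̄ 1 → next C'-pbij x ≡ next pC x
  next'≡next x d a₁ a₂ a₃ b₁ b₂ b₃ with next-spec pC d
  ... | w , e₁ , e₂ = next-unique C'-pbij (trans (C'≡C (partner x) a₁ a₂ a₃) e₁) (trans (C'≡C (next pC x) b₁ b₂ b₃) e₂)

  next'-orb : ∀ i → i ≤ k → next C'-pbij (orb (suc i)) ≡ orb (suc (suc i))
  next'-orb i i≤k = next'≡next (orb (suc i)) (orb-inDom (suc i))
    (λ eq → orb≢partner-z (suc i) (trans (sym (partner-involutive (orb (suc i)))) (cong partner eq)))
    (λ eq → ℕP.1+n≢0 (orb-injective (s≤s (s≤s i≤k+1)) (s≤s z≤n) (partner-injective eq)))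
    (λ eq → ℕP.<⇒≢ (s≤s i≤k) (ℕP.suc-injective (orb-injective (s≤s (s≤s i≤k+1)) (s≤s ℕP.≤-refl)
              (trans (sym (partner-involutive (orb (suc i)))) (trans (cong partner eq) partner-orb̄1)))))
    (λ eq → ℕP.1+n≢0 (orb-injective (s≤s (s≤s (s≤s i≤k))) (s≤s z≤n) eq))
    (orb≢partner-z (suc (suc i)))
    (orb≢orb̄ (suc (suc i)) 1)
    where
    i≤k+1 : i ≤ suc k
    i≤k+1 = ℕP.m≤n⇒m≤1+n i≤k

  next'-orb̄ : ∀ j → j ≤ k → next C'-pbij (orb̄ (suc j)) ≡ orb̄ (suc (suc j))
  next'-orb̄ j j≤k = next'≡next (orb̄ (suc j)) (orb̄-inDom (suc j))
    (λ eq → ℕP.1+n≢0 (orb̄-injective (s≤s (s≤s (ℕP.m≤n⇒m≤1+n j≤k))) (s≤s z≤n)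
              (trans (sym (partner-involutive (orb̄ (suc j)))) (cong partner eq))))
    (λ eq → orb≢orb̄ 0 (suc j) (sym (partner-injective eq)))
    (λ eq → orb≢orb̄ (suc (suc k)) (suc j) (sym (trans (sym (partner-involutive (orb̄ (suc j)))) (trans (cong partner eq) partner-orb̄1))))
    (λ eq → orb≢orb̄ 0 (suc (suc j)) (sym eq))
    (λ eq → ℕP.1+n≢0 (orb̄-injective (s≤s (s≤s (s≤s j≤k))) (s≤s z≤n) eq))
    (λ eq → ℕP.1+n≢0 (ℕP.suc-injective (orb̄-injective (s≤s (s≤s (s≤s j≤k))) (s≤s (s≤s z≤n)) eq)))

  orb̄1∉z : proj₁ (orb̄ 1) ≢ proj₁ z
  orb̄1∉z eb with sameBlock {x = orb̄ 1} {y = z} eb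
  ... | inj₁ e = orb≢orb̄ 0 1 (sym e)
  ... | inj₂ e = ℕP.1+n≢0 (orb̄-injective (s≤s (s≤s z≤n)) (s≤s z≤n) e)

  C'-orb̄1 : C' (orb̄ 1) ≡ just v
  C'-orb̄1 = trans (C'-elsewhere {orb̄ 1} orb̄1∉z) (trans (C̃-just C-orb̄1) (cong just swap-b))

  C'-orb1 : C' (orb 1) ≡ just (partner v)
  C'-orb1 = trans (C'≡C (orb 1) orb1≢z (orb≢partner-z 1) (orb≢orb̄ 1 1)) C-orb1

  -- In C' the walk jumps from orb (k+2) straight back to orb 1, skipping z.
  next'-orb-last : next C'-pbij (orb (suc (suc k))) ≡ orb 1
  next'-orb-last = next-unique C'-pbij
    (trans (cong C' (trans (cong partner (sym partner-orb̄1)) (partner-involutive (orb̄ 1)))) C'-orb̄1) C'-orb1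

  partner-orb̄-last : partner (orb̄ (suc (suc k))) ≡ orb 1
  partner-orb̄-last = trans (cong partner (sym partner-orb1)) (partner-involutive (orb 1))

  next'-orb̄-last : next C'-pbij (orb̄ (suc (suc k))) ≡ orb̄ 1
  next'-orb̄-last = next-unique C'-pbij (trans (cong C' partner-orb̄-last) C'-orb1)
                                         (trans C'-orb̄1 (cong just (sym (partner-involutive v))))

  next'^-orb : ∀ j → j ≤ suc k → next^ C'-pbij j (orb 1) ≡ orb (suc j)
  next'^-orb zero _ = refl
  next'^-orb (suc j) (s≤s j≤k) = trans (cong (next C'-pbij) (next'^-orb j (ℕP.m≤n⇒m≤1+n j≤k))) (next'-orb j j≤k)

  next'^-orb̄ : ∀ j → j ≤ suc k → next^ C'-pbij (suc j) (orb̄ (suc (suc k))) ≡ orb̄ (suc j)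
  next'^-orb̄ zero _ = next'-orb̄-last
  next'^-orb̄ (suc j) (s≤s j≤k) = trans (cong (next C'-pbij) (next'^-orb̄ j (ℕP.m≤n⇒m≤1+n j≤k))) (next'-orb̄ j j≤k)

  C'-singleCycle : SingleCycle C'-pbij (orb 1) (suc k)
  C'-singleCycle = record
    { inDom-base = inDom-just {σ = C'} C'-orb1
    ; length≤ = ℕP.≤-trans (ℕP.n≤1+n _) length≤
    ; period = record { returns = trans (cong (next C'-pbij) (next'^-orb (suc k) ℕP.≤-refl)) next'-orb-last
                      ; minimal = C'-minimal }
    ; covers = C'-covers }
    where
    C'-minimal : ∀ j → 1 ≤ j → j < suc (suc k) → next^ C'-pbij j (orb 1) ≢ orb 1
    C'-minimal j 1≤j (s≤s j≤k+1) eq =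
      ℕP.<⇒≢ 1≤j (sym (ℕP.suc-injective (orb-injective (s≤s (s≤s j≤k+1)) (s≤s (s≤s z≤n))
                                                        (trans (sym (next'^-orb j j≤k+1)) eq))))
    C'-covers : ∀ y → inDom C' y ≡ true → Σ ℕ (λ j → y ≡ next^ C'-pbij j (orb 1) ⊎ y ≡ next^ C'-pbij j (partner (orb 1)))
    C'-covers y d with inDom⇒just {σ = C'} d
    ... | w , ew with C'-just⁻ {y} ew
    ...   | C̃y , y∉z with C̃-just⁻ C̃y
    ...     | a , Cy , _ with covers y (inDom-just {σ = C} Cy)
    ...       | j , inj₁ y≡ with j % len | m%n<n j len | next^-mod pC period j
    ...         | zero | _ | r = ⊥-elim (y∉z (cong proj₁ (trans y≡ r)))
    ...         | suc i | s≤s i<len | r = i , inj₁ (trans y≡ (trans r (sym (next'^-orb i (ℕP.≤-pred i<len)))))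
    C'-covers y d | w , ew | C̃y , y∉z | a , Cy , _ | j , inj₂ y≡ with j % len | m%n<n j len | next^-mod pC z̄-period j
    ...         | zero | _ | r = ⊥-elim (y∉z (cong proj₁ (trans y≡ r)))
    ...         | suc i | s≤s i<len | r = suc i , inj₂ (trans y≡ (trans r
                    (sym (trans (cong (next^ C'-pbij (suc i)) partner-orb1) (next'^-orb̄ i (ℕP.≤-pred i<len))))))

  ct-C' : ct C' ≡ suc (suc k) ∷ []
  ct-C' = singleCycle⇒ct C'-pbij C'-singleCycle

  C̃-extends : ∀ x → inDom C' x ≡ true → C̃ x ≡ C' x
  C̃-extends x d with inDom⇒just {σ = C'} d
  ... | w , ew = trans (proj₁ (C'-just⁻ {x} ew)) (sym ew)

  C̃-new-block : ∀ x w → inDom C' x ≡ false → C̃ x ≡ just w → C̃ (partner x) ≡ just (partner w)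
  C̃-new-block x w d ew with proj₁ x Fin.≟ proj₁ z
  ... | no _ = ⊥-elim (true≢false (trans (sym (inDom-just {σ = C̃} ew)) d))
  ... | yes x∈z with sameBlock {x = x} {y = z} x∈z
  ...   | inj₁ refl = trans (C̃-just Cz̄) (cong just (trans swap-a (cong partner u≡w)))
    where
    u≡w : u ≡ w
    u≡w = MaybeP.just-injective (trans (cong just (sym swap-u)) (trans (sym (C̃-just Cz)) ew))
  ...   | inj₂ refl = trans (cong C̃ (partner-involutive z))
                        (trans (C̃-just Cz) (cong just (trans swap-u (trans (sym (partner-involutive u)) (cong partner ū≡w)))))
    where
    ū≡w : partner u ≡ w
    ū≡w = MaybeP.just-injective (trans (cong just (sym swap-a)) (trans (sym (C̃-just Cz̄)) ew))

  inBlocks-uv⇒inIm : ∀ y → InBlocks-uv y → inIm C y ≡ true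
  inBlocks-uv⇒inIm y (inj₁ y∈u) with sameBlock {x = y} {y = u} y∈u
  ... | inj₁ refl = inIm-just {σ = C} Cz
  ... | inj₂ refl = ū∈Im
  inBlocks-uv⇒inIm y (inj₂ y∈v) with sameBlock {x = y} {y = v} y∈v
  ... | inj₁ refl = v∈Im
  ... | inj₂ refl = trans (im-partner v) v∈Im

  τ̃-extends : ∀ x → inDom τ x ≡ true → τ̃ x ≡ τ x
  τ̃-extends x d = trans (τ̃-just (inBlocks-uv⇒inIm x b)) (sym (τ-just {x} b))
    where
    b : InBlocks-uv x
    b = inDom-τ⇒inBlocks-uv {x} d

  swap-outside-uv : ∀ {x} → ¬ InBlocks-uv x → swap x ≡ x
  swap-outside-uv ¬b = swap-fixed (λ e → ¬b (inj₂ (cong proj₁ e))) (λ e → ¬b (inj₁ (cong proj₁ e)))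

  τ̃-new-block : ∀ x w → inDom τ x ≡ false → τ̃ x ≡ just w → τ̃ (partner x) ≡ just (partner w)
  τ̃-new-block x w d ew with τ̃-just⁻ {x} ew
  ... | x∈Im , refl = trans (τ̃-just (trans (im-partner x) x∈Im))
                            (cong just (trans (swap-outside-uv ¬b) (cong partner (sym (swap-outside-uv ¬b)))))
    where
    ¬b : ¬ InBlocks-uv x
    ¬b b = true≢false (trans (sym (inDom-just {σ = τ} (τ-just {x} b))) d)

  inIm-C-split : ∀ x → inIm C x ≡ (inDom τ x ∨ inIm C' x)
  inIm-C-split x with inBlocks-uv? x
  ... | yes b rewrite τ-just {x} b = inBlocks-uv⇒inIm x b
  ... | no ¬b rewrite τ-nothing {x} ¬b = Bool-ext (λ i → proj₂ (inIm-C'⇔ x) (i , λ e → ¬b (inj₁ e))) (λ i → proj₁ (proj₁ (inIm-C'⇔ x) i))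

  inDom-τ̃-split : ∀ x → inDom τ̃ x ≡ (inDom τ x ∨ inIm C' x)
  inDom-τ̃-split x = trans (inDom-τ̃ x) (inIm-C-split x)

  inIm-C̃-split : ∀ x → inIm C̃ x ≡ (inDom τ x ∨ inIm C' x)
  inIm-C̃-split x = trans (inIm-C̃ x) (inIm-C-split x)

  τ̃∘C̃≡C : ∀ x → compose τ̃ C̃ x ≡ C x
  τ̃∘C̃≡C x with C x in Cx
  ... | nothing = refl
  ... | just a = trans (τ̃-just (trans (inIm-swap a) (inIm-just {σ = C} Cx))) (cong just (swap-involutive a))

  C̃-trivExt : isTrivExt C' C̃ ≡ true
  C̃-trivExt = TrivialExtension.isTrivExt-extension C'-pbij C̃-pbij C̃-extends C̃-new-block

  τ̃-trivExt : isTrivExt τ τ̃ ≡ true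
  τ̃-trivExt = TrivialExtension.isTrivExt-extension τ-pbij τ̃-pbij τ̃-extends τ̃-new-block

  Eset-witness : Σ (Raw n × Raw n) (λ p → p ∈ Eset τ C' × eqRaw (compose (proj₁ p) (proj₂ p)) C ≡ true)
  Eset-witness with validRaws-complete τ̃ τ̃-pbij | validRaws-complete C̃ C̃-pbij
  ... | τ̃c , τ̃c∈ , τ̃c≗τ̃ | C̃c , C̃c∈ , C̃c≗C̃ = (τ̃c , C̃c) , p∈E , composes
    where
    p∈E : (τ̃c , C̃c) ∈ Eset τ C'
    p∈E = ∈-filterᵇ⁺
      (∈-cartesianProduct⁺ (∈-filterᵇ⁺ τ̃c∈ (trans (isTrivExt-≗ʳ τ̃c≗τ̃ τ) τ̃-trivExt))
                           (∈-filterᵇ⁺ C̃c∈ (trans (isTrivExt-≗ʳ C̃c≗C̃ C') C̃-trivExt)))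
      (allᵇ⁺ (allPts n) λ x _ → ∧-true
        (eqBool-≡ (trans (inDom-≗ τ̃c≗τ̃ x) (inDom-τ̃-split x)))
        (eqBool-≡ (trans (inIm-≗ C̃c≗C̃ x) (inIm-C̃-split x))))
    composes : eqRaw (compose τ̃c C̃c) C ≡ true
    composes = allᵇ⁺ (allPts n) λ x _ → eqMPt-≡ (trans (compose-≗ τ̃c≗τ̃ C̃c≗C̃ x) (τ̃∘C̃≡C x))

  τ-copy : Σ (Raw n) (λ c → c ∈ validRaws n × c ≗ τ)
  τ-copy = validRaws-complete τ τ-pbij

  C'-copy : Σ (Raw n) (λ c → c ∈ validRaws n × c ≗ C')
  C'-copy = validRaws-complete C' C'-pbij

  τQ : Q n
  τQ = toQ (proj₁ (proj₂ τ-copy))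

  C'Q : Q n
  C'Q = toQ (proj₁ (proj₂ C'-copy))

  cosetType-τQ : cosetType τQ ≡ 2 ∷ []
  cosetType-τQ = trans (ct-≗ (proj₂ (proj₂ τ-copy))) ct-τ

  cosetType-C'Q : cosetType C'Q ≡ suc (suc k) ∷ []
  cosetType-C'Q = trans (ct-≗ (proj₂ (proj₂ C'-copy))) ct-C'

  τQ∷-pos : ∀ {r} (τs : Vec (Q n) (suc r)) → 0ℚ ℚ.< coeff (prodVec τs) C'Q → 0ℚ ℚ.< prodVec (τQ ∷ τs) C
  τQ∷-pos (t ∷ ts) 0<coeff =
    ⋆-pos (basis-nonNeg τQ) (prodVec-nonNeg (t ∷ ts)) (proj₁ (proj₂ τ-copy)) (proj₁ (proj₂ C'-copy))
      (subst (0ℚ ℚ.<_) (sym (basis-self τQ)) 0<1) 0<coeff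
      (subst (0ℚ ℚ.<_) (sym (basisProd-≗ C (proj₂ (proj₂ τ-copy)) (proj₂ (proj₂ C'-copy))))
             (basisProd-pos τ C' C (proj₁ (proj₂ Eset-witness)) (proj₂ (proj₂ Eset-witness))))

  prepend-τ : TranspositionWitness (suc k) (proj₁ C'Q) → TranspositionWitness (suc (suc k)) C
  prepend-τ (τs , cts , 0<coeff) =
    τQ ∷ τs , (λ { Fin.zero → cosetType-τQ ; (Fin.suc i) → cts i }) , τQ∷-pos τs 0<coeff

transpositions-reach-cycle : ∀ {n} k (C : Q n) → cosetType C ≡ suc (suc k) ∷ [] →
  TranspositionWitness (suc k) (proj₁ C)
transpositions-reach-cycle zero C ct≡ =
  C ∷ [] , (λ { Fin.zero → ct≡ }) , subst (0ℚ ℚ.<_) (sym (basis-self C)) 0<1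
transpositions-reach-cycle {n} (suc k) (C , valid-C) ct≡ =
  prepend-τ (transpositions-reach-cycle k C'Q cosetType-C'Q)
  where
  pC : IsPBij C
  pC = valid⇒IsPBij valid-C
  cycle : SingleCycle pC (proj₁ (ct⇒singleCycle pC ct≡)) (suc (suc k))
  cycle = proj₂ (ct⇒singleCycle pC ct≡)
  open SingleCycle cycle using (inDom-base)
  open Split pC cycle (proj₂ (inDom⇒just {σ = C} inDom-base))
                      (proj₂ (inDom⇒just {σ = C} (IsPBij.inDom-partner pC inDom-base)))

lemma6p1 : (n : ℕ) → 1 ≤ n → (r : ℕ) → 1 ≤ r → (C : Q n) →
    cosetType C ≡ (r + 1) ∷ [] →
    Σ (Vec (Q n) r) (λ τ →
      ((i : Fin r) → cosetType (lookup τ i) ≡ 2 ∷ []) × coeff (prodVec τ) C ≢ 0ℚ)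
lemma6p1 n _ (suc k) (s≤s z≤n) C ct≡
  with transpositions-reach-cycle k C (trans ct≡ (cong (λ m → suc m ∷ []) (ℕP.+-comm k 1)))
... | τ , cts , 0<coeff = τ , cts , λ coeff≡0 → ℚP.<⇒≢ 0<coeff (sym coeff≡0)
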